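{- For fixed integers $d\ge1$ and $k\ge2^d$, we have $f(n,k,d)=(1+o(1))\,\lambda(H(k,d))\,n^d$ as $n\to\infty$.
   Context: A family $\mathcal{F}$ of subsets of $[n]$ shatters $A\subseteq[n]$ if for every $A'\subseteq A$ there is $F\in\mathcal{F}$ with $F\cap A=A'$; $f(n,k,d)$ is the maximum number of $d$-subsets of $[n]$ shattered by some $\mathcal{F}\subseteq 2^{[n]}$ with $|\mathcal{F}|\le k$. A $k\times d$ binary matrix is shattered if each vector in $\{0,1\}^d$ appears among its rows. $H(k,d)$ is the $d$-uniform hypergraph on vertex set $\{0,1\}^k$ whose edges are the sets of $d$ distinct vectors forming, as columns, a shattered $k\times d$ matrix. The Lagrangian $\lambda(H)$ of a $d$-uniform hypergraph $H$ is the maximum of $\sum_{e\in E(H)}\prod_{v\in e}x_v$ over $x_v\ge0$, $\sum_v x_v=1$.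
   Formalization: The positive error bound in the (1+o(1)) term is taken rational, and the Lagrangian λ(H(k,d)) is a maximum over points of the simplex with rational coordinates. -}

module Defs where

open import Data.Bool using (Bool; true; false)
open import Data.Nat as ℕ using (ℕ; zero; suc; _⊔_; _≤?_)
open import Data.Nat.Properties using () renaming (_≟_ to _≟ℕ_)
open import Data.Fin using (Fin)
open import Data.Fin.Subset using (Subset; _∩_; _⊆_; ∣_∣)
open import Data.Fin.Subset.Properties using (_⊆?_)
open import Data.Vec as Vec using (Vec; []; _∷_; lookup)
import Data.Vec.Properties as VecP
open import Data.Bool.Properties using () renaming (_≟_ to _≟B_)
open import Data.List as List using (List; []; _∷_; _++_; map; filter; length; foldr; allFin)
import Data.List.Properties as ListP
open import Data.List.Relation.Unary.All using (All; all?)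
open import Data.List.Relation.Unary.Any using (Any; any?)
open import Data.Rational as ℚ using (ℚ; 0ℚ; 1ℚ; _+_; _*_; _≤_)
open import Data.Integer using (+_)
open import Data.Product using (_×_)
open import Relation.Nullary using (Dec; yes; no)
open import Relation.Nullary.Decidable using (_→-dec_)
open import Relation.Binary.PropositionalEquality using (_≡_)

allSubsets : (n : ℕ) → List (Subset n)
allSubsets zero    = [] ∷ []
allSubsets (suc n) = map (true ∷_) (allSubsets n) ++ map (false ∷_) (allSubsets n)

-- all sublists (subsequences) of a list; applied to a duplicate-free
-- list this enumerates each finite subset exactly once
sublists : {A : Set} → List A → List (List A)
sublists []       = [] ∷ []
sublists (x ∷ xs) = map (x ∷_) (sublists xs) ++ sublists xs

dSubsets : (n d : ℕ) → List (Subset n)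
dSubsets n d = filter (λ A → ∣ A ∣ ≟ℕ d) (allSubsets n)

-- all families F ⊆ 2^[n] with |F| ≤ k (a family = duplicate-free list)
families : (n k : ℕ) → List (List (Subset n))
families n k = filter (λ F → length F ≤? k) (sublists (allSubsets n))

Shatters : {n : ℕ} → List (Subset n) → Subset n → Set
Shatters {n} F A =
  All (λ A' → A' ⊆ A → Any (λ G → G ∩ A ≡ A') F) (allSubsets n)

shatters? : {n : ℕ} (F : List (Subset n)) (A : Subset n) → Dec (Shatters F A)
shatters? F A = all? (λ A' → (A' ⊆? A) →-dec any? (λ G → VecP.≡-dec _≟B_ (G ∩ A) A') F) _

numShattered : {n : ℕ} → ℕ → List (Subset n) → ℕ
numShattered {n} d F = length (filter (shatters? F) (dSubsets n d))

maxℕ : List ℕ → ℕ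
maxℕ = foldr _⊔_ 0

f : (n k d : ℕ) → ℕ
f n k d = maxℕ (map (numShattered d) (families n k))

Vertex : ℕ → Set
Vertex k = Vec Bool k

-- i-th row of the k × d matrix whose columns are the given vectors
row : {k : ℕ} → List (Vertex k) → Fin k → List Bool
row cs i = map (λ c → lookup c i) cs

ShatteredMatrix : {k : ℕ} → List (Vertex k) → Set
ShatteredMatrix {k} cs =
  All (λ w → Any (λ i → row cs i ≡ w) (allFin k))
      (map Vec.toList (allSubsets (length cs)))

shatteredMatrix? : {k : ℕ} (cs : List (Vertex k)) → Dec (ShatteredMatrix cs)
shatteredMatrix? {k} cs =
  all? (λ w → any? (λ i → ListP.≡-dec _≟B_ (row cs i) w) (allFin k)) _

-- edges of H(k,d): sets of d distinct vertices (duplicate-free sublists of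
-- the duplicate-free vertex list) whose columns form a shattered matrix
edges : (k d : ℕ) → List (List (Vertex k))
edges k d = filter (λ e → length e ≟ℕ d) (filter shatteredMatrix? (sublists (allSubsets k)))

ℕtoℚ : ℕ → ℚ
ℕtoℚ n = + n ℚ./ 1

sumℚ : List ℚ → ℚ
sumℚ = foldr _+_ 0ℚ

prodℚ : List ℚ → ℚ
prodℚ = foldr _*_ 1ℚ

lagPoly : (k d : ℕ) → (Vertex k → ℚ) → ℚ
lagPoly k d x = sumℚ (map (λ e → prodℚ (map x e)) (edges k d))

InSimplex : (k : ℕ) → (Vertex k → ℚ) → Set
InSimplex k x = All (λ v → 0ℚ ≤ x v) (allSubsets k) × sumℚ (map x (allSubsets k)) ≡ 1ℚ

-- Blow-up: in a k × n 0/1-matrix whose columns take the value v ∈ {0,1}^k with multiplicity c v, a set A of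
-- d columns is shattered by the rows iff the columns in A enumerate, each once, an edge of H(k,d); so the rows
-- shatter exactly ∑_{e ∈ H(k,d)} ∏_{v ∈ e} c v d-sets. As families of at most k sets are the row sets of such
-- matrices, f(n,k,d) is the maximum of this polynomial over c with ∑ c = n. Writing c = n x with x in the simplex
-- gives f(n,k,d) ≤ λ n^d at once. Conversely, rounding n x down to integers loses O(n^(d-1)) per edge, a vanishing
-- fraction of f(n,k,d), which grows like n^d because ⌊n / 2^k⌋ copies of every vertex already give ⌊n / 2^k⌋^d.
module Submission where

open import Defs
import Algebra.Properties.CommutativeSemigroup as CommutativeSemigroupProperties
open import Data.Bool using (Bool; true; false; _∧_)
open import Data.Bool.Properties using (∧-identityʳ; ∧-zeroʳ) renaming (_≟_ to _≟ᴮ_)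
open import Data.Empty using (⊥; ⊥-elim)
open import Data.Fin using (Fin; toℕ; fromℕ<)
open import Data.Fin.Properties using (toℕ-fromℕ<)
open import Data.Fin.Subset using (Subset; _∩_; _⊆_; ∣_∣)
open import Data.Fin.Subset.Properties using (drop-∷-⊆; out⊆; s⊆s; ⊥⊆; ∩-zeroˡ; p∩q⊆q)
open import Data.List as List using (List; []; _∷_; _++_; map; filter; length)
open import Data.List.Properties
  using (length-replicate; length-tabulate; length-++; length-++-sucʳ; length-map; map-cong; map-cong-local;
         filter-≐; filter-++; filter-none; filter-all; filter-accept; filter-reject; ∷-injectiveˡ; ∷-injectiveʳ)
open import Data.List.Membership.Propositional using (_∈_; _∉_; find)
open import Data.List.Membership.Propositional.Properties
  using (∈-∃++; ∈-++⁺ˡ; ∈-++⁺ʳ; ∈-++⁻; ∈-map⁺; ∈-map⁻; ∈-filter⁺; ∈-filter⁻; ∈-allFin; foldr-selective)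
open import Data.List.Relation.Binary.Disjoint.Propositional using (Disjoint)
open import Data.List.Relation.Binary.Subset.Propositional using () renaming (_⊆_ to _⊆ₗ_)
open import Data.List.Relation.Unary.All as All using (All; []; _∷_)
open import Data.List.Relation.Unary.AllPairs using ([]; _∷_)
open import Data.List.Relation.Unary.Any as Any using (Any; here; there; any?)
open import Data.List.Relation.Unary.Unique.Propositional using (Unique)
import Data.List.Relation.Unary.Unique.Propositional.Properties as Unique
open import Data.Nat as ℕ using (ℕ; zero; suc; _^_; _≤_; _<_; _≤?_; z≤n; s≤s; >-nonZero)
open import Data.Nat.DivMod using (_/_; _%_; m≡m%n+[m/n]*n; m%n<n; m/n*n≤m; m≥n⇒m/n>0)
open import Data.Nat.ListAction using (sum; product)
open import Data.Nat.Properties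
  using (+-commutativeSemigroup; *-commutativeSemigroup; +-assoc; *-assoc; *-comm; +-suc; +-identityʳ; *-distribˡ-+;
         ≤-refl; ≤-reflexive; ≤-trans; ≤-antisym; <⇒≤; <-≤-trans; m≤m+n; m≤n+m; m≤n*m; m≤m⊔n; m≤n⊔m; ⊔-sel;
         +-mono-≤; +-monoˡ-≤; +-monoʳ-≤; *-mono-≤; *-monoʳ-≤; ^-monoˡ-≤; m^n≢0; module ≤-Reasoning)
open CommutativeSemigroupProperties +-commutativeSemigroup using () renaming (interchange to +-interchange)
open CommutativeSemigroupProperties *-commutativeSemigroup using () renaming (interchange to *-interchange)
open import Data.Product using (_×_; _,_; proj₁; proj₂; ∃)
open import Data.Sum using (_⊎_; inj₁; inj₂)
open import Data.Vec as Vec using (Vec; []; _∷_; toList)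
open import Data.Vec.Properties
  using (≡-dec; map-const; toList-map; toList∘fromList; length-toList; lookup∘tabulate; tabulate∘lookup; tabulate-cong; tabulate-∘)
  renaming (∷-injectiveʳ to ∷ᵛ-injectiveʳ)
open import Level using (0ℓ)
open import Relation.Binary.Definitions using (DecidableEquality)
open import Relation.Binary.PropositionalEquality using (_≡_; _≢_; refl; sym; trans; cong; cong₂; subst; subst₂; module ≡-Reasoning)
open import Relation.Nullary using (Dec; yes; no; ¬_; ¬?; does)
open import Relation.Nullary.Decidable using (_×-dec_)
open import Relation.Unary using (Pred; Decidable; _≐_)
open import Relation.Unary.Properties using (_∪?_; _∩?_)

module Counting where

  open import Data.Nat using (_+_; _*_)

  count : {A : Set} {P : Pred A 0ℓ} → Decidable P → List A → ℕ
  count P? xs = length (filter P? xs)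

  module _ {A : Set} where

    module _ {P : Pred A 0ℓ} (P? : Decidable P) where

      count-++ : ∀ xs ys → count P? (xs ++ ys) ≡ count P? xs + count P? ys
      count-++ xs ys = trans (cong length (filter-++ P? xs ys)) (length-++ (filter P? xs))

      count-none : (∀ x → ¬ P x) → ∀ xs → count P? xs ≡ 0
      count-none ¬P xs = cong length (filter-none P? (All.universal ¬P xs))

      count-map : {B : Set} (g : B → A) → ∀ xs → count P? (map g xs) ≡ count (λ x → P? (g x)) xs
      count-map g [] = refl
      count-map g (x ∷ xs) with does (P? (g x))
      ... | true  = cong suc (count-map g xs)
      ... | false = count-map g xs

      module _ {Q : Pred A 0ℓ} (Q? : Decidable Q) where

        count-≐ : P ≐ Q → ∀ xs → count P? xs ≡ count Q? xs
        count-≐ P≐Q xs = cong length (filter-≐ P? Q? P≐Q xs)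

        count-∪ : (∀ {x} → P x → Q x → ⊥) → ∀ xs → count (P? ∪? Q?) xs ≡ count P? xs + count Q? xs
        count-∪ disjoint [] = refl
        count-∪ disjoint (x ∷ xs) with P? x | Q? x
        ... | yes p | yes q = ⊥-elim (disjoint p q)
        ... | yes _ | no _  = cong suc (count-∪ disjoint xs)
        ... | no _  | yes _ = trans (cong suc (count-∪ disjoint xs)) (sym (+-suc _ _))
        ... | no _  | no _  = count-∪ disjoint xs

        count-filter : ∀ xs → count P? (filter Q? xs) ≡ count (Q? ∩? P?) xs
        count-filter [] = refl
        count-filter (x ∷ xs) with Q? x
        ... | no _ = count-filter xs
        ... | yes _ with P? x
        ...   | yes _ = cong suc (count-filter xs)
        ...   | no _  = count-filter xs

    count-any : {B : Set} {R : A → B → Set} (R? : ∀ x e → Dec (R x e)) (E : List B) → Unique E →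
                (∀ {x e e′} → e ∈ E → e′ ∈ E → R x e → R x e′ → e ≡ e′) →
                ∀ xs → count (λ x → any? (R? x) E) xs ≡ sum (map (λ e → count (λ x → R? x e) xs) E)
    count-any R? [] _ _ xs = count-none (λ x → any? (R? x) []) (λ _ ()) xs
    count-any {R = R} R? (e ∷ E) (e∉E ∷ uniqueE) functional xs = begin
      count (λ x → any? (R? x) (e ∷ E)) xs
        ≡⟨ count-≐ (λ x → any? (R? x) (e ∷ E)) ((λ x → R? x e) ∪? (λ x → any? (R? x) E)) (split , join) xs ⟩
      count ((λ x → R? x e) ∪? (λ x → any? (R? x) E)) xs
        ≡⟨ count-∪ (λ x → R? x e) (λ x → any? (R? x) E) disjoint xs ⟩
      count (λ x → R? x e) xs + count (λ x → any? (R? x) E) xs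
        ≡⟨ cong (count (λ x → R? x e) xs +_) (count-any R? E uniqueE (λ p q → functional (there p) (there q)) xs) ⟩
      sum (map (λ e → count (λ x → R? x e) xs) (e ∷ E)) ∎
      where
      open ≡-Reasoning
      split : ∀ {x} → Any (R x) (e ∷ E) → R x e ⊎ Any (R x) E
      split (here r)  = inj₁ r
      split (there r) = inj₂ r
      join : ∀ {x} → R x e ⊎ Any (R x) E → Any (R x) (e ∷ E)
      join (inj₁ r) = here r
      join (inj₂ r) = there r
      disjoint : ∀ {x} → R x e → Any (R x) E → ⊥
      disjoint r r′ with find r′
      ... | e′ , e′∈E , r″ = All.lookup e∉E e′∈E (functional (here refl) (there e′∈E) r r″)

    Unique⇒length≤ : {xs ys : List A} → Unique xs → xs ⊆ₗ ys → length xs ≤ length ys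
    Unique⇒length≤ {[]}     _               _  = z≤n
    Unique⇒length≤ {x ∷ xs} (x∉xs ∷ unique) xs⊆ys with ∈-∃++ (xs⊆ys (here refl))
    ... | as , bs , refl = subst (suc (length xs) ≤_) (sym (length-++-sucʳ as x bs))
                                 (s≤s (Unique⇒length≤ unique avoid-x))
      where
      avoid-x : xs ⊆ₗ as ++ bs
      avoid-x {z} z∈xs with ∈-++⁻ as (xs⊆ys (there z∈xs))
      ... | inj₁ z∈as         = ∈-++⁺ˡ z∈as
      ... | inj₂ (here refl)  = ⊥-elim (All.lookup x∉xs z∈xs refl)
      ... | inj₂ (there z∈bs) = ∈-++⁺ʳ as z∈bs

  module _ {A : Set} where

    ∈-sublists-∷⁻ : ∀ x xs {e} → e ∈ sublists (x ∷ xs) →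
                    (∃ λ e′ → e′ ∈ sublists xs × e ≡ x ∷ e′) ⊎ e ∈ sublists {A} xs
    ∈-sublists-∷⁻ x xs e∈ with ∈-++⁻ (map (x ∷_) (sublists xs)) e∈
    ... | inj₁ e∈map = inj₁ (∈-map⁻ (x ∷_) e∈map)
    ... | inj₂ e∈    = inj₂ e∈

    filter∈sublists : {P : Pred A 0ℓ} (P? : Decidable P) (xs : List A) → filter P? xs ∈ sublists xs
    filter∈sublists P? [] = here refl
    filter∈sublists P? (x ∷ xs) with does (P? x)
    ... | true  = ∈-++⁺ˡ (∈-map⁺ (x ∷_) (filter∈sublists P? xs))
    ... | false = ∈-++⁺ʳ (map (x ∷_) (sublists xs)) (filter∈sublists P? xs)

    ∈-sublists⇒⊆ : {xs e : List A} → e ∈ sublists xs → e ⊆ₗ xs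
    ∈-sublists⇒⊆ {[]} (here refl) ()
    ∈-sublists⇒⊆ {x ∷ xs} e∈ with ∈-sublists-∷⁻ x xs e∈
    ... | inj₁ (e′ , e′∈ , refl) = λ { (here refl) → here refl ; (there z∈) → there (∈-sublists⇒⊆ e′∈ z∈) }
    ... | inj₂ e∈′               = λ z∈ → there (∈-sublists⇒⊆ e∈′ z∈)

    module _ {x : A} {xs : List A} (x∉xs : All (x ≢_) xs) where

      ∉-sublist : {e : List A} → e ∈ sublists xs → x ∉ e
      ∉-sublist e∈ x∈e = All.lookup x∉xs (∈-sublists⇒⊆ e∈ x∈e) refl

      ∷-cancel-⊆ : {a b : List A} → a ∈ sublists xs → x ∷ a ⊆ₗ x ∷ b → a ⊆ₗ b
      ∷-cancel-⊆ a∈ xa⊆xb z∈a with xa⊆xb (there z∈a)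
      ... | here refl = ⊥-elim (∉-sublist a∈ z∈a)
      ... | there z∈b = z∈b

    Unique-∈-sublists : {xs e : List A} → Unique xs → e ∈ sublists xs → Unique e
    Unique-∈-sublists {[]} _ (here refl) = []
    Unique-∈-sublists {x ∷ xs} (x∉xs ∷ unique) e∈ with ∈-sublists-∷⁻ x xs e∈
    ... | inj₁ (e′ , e′∈ , refl) =
          All.tabulate (λ z∈ x≡z → ∉-sublist x∉xs e′∈ (subst (_∈ e′) (sym x≡z) z∈)) ∷ Unique-∈-sublists unique e′∈
    ... | inj₂ e∈′ = Unique-∈-sublists unique e∈′

    Unique-sublists : {xs : List A} → Unique xs → Unique (sublists xs)
    Unique-sublists {[]} _ = [] ∷ []
    Unique-sublists {x ∷ xs} (x∉xs ∷ unique) =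
      Unique.++⁺ (Unique.map⁺ ∷-injectiveʳ (Unique-sublists unique)) (Unique-sublists unique) disjoint
      where
      disjoint : Disjoint (map (x ∷_) (sublists xs)) (sublists xs)
      disjoint (e∈map , e∈) with ∈-map⁻ (x ∷_) e∈map
      ... | _ , _ , refl = ∉-sublist x∉xs e∈ (here refl)

    sublists-≡ : {xs a b : List A} → Unique xs → a ∈ sublists xs → b ∈ sublists xs →
                 a ⊆ₗ b → b ⊆ₗ a → a ≡ b
    sublists-≡ {[]} _ (here refl) (here refl) _ _ = refl
    sublists-≡ {x ∷ xs} (x∉xs ∷ unique) a∈ b∈ a⊆b b⊆a with ∈-sublists-∷⁻ x xs a∈ | ∈-sublists-∷⁻ x xs b∈
    ... | inj₁ (a′ , a′∈ , refl) | inj₁ (b′ , b′∈ , refl) =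
          cong (x ∷_) (sublists-≡ unique a′∈ b′∈ (∷-cancel-⊆ x∉xs a′∈ a⊆b) (∷-cancel-⊆ x∉xs b′∈ b⊆a))
    ... | inj₁ (_ , _ , refl) | inj₂ b∈′ = ⊥-elim (∉-sublist x∉xs b∈′ (a⊆b (here refl)))
    ... | inj₂ a∈′ | inj₁ (_ , _ , refl) = ⊥-elim (∉-sublist x∉xs a∈′ (b⊆a (here refl)))
    ... | inj₂ a∈′ | inj₂ b∈′ = sublists-≡ unique a∈′ b∈′ a⊆b b⊆a

  ∈-allSubsets : {n : ℕ} (A : Subset n) → A ∈ allSubsets n
  ∈-allSubsets [] = here refl
  ∈-allSubsets {suc n} (true ∷ A)  = ∈-++⁺ˡ (∈-map⁺ (true ∷_) (∈-allSubsets A))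
  ∈-allSubsets {suc n} (false ∷ A) = ∈-++⁺ʳ (map (true ∷_) (allSubsets n)) (∈-map⁺ (false ∷_) (∈-allSubsets A))

  Unique-allSubsets : (n : ℕ) → Unique (allSubsets n)
  Unique-allSubsets zero = [] ∷ []
  Unique-allSubsets (suc n) =
    Unique.++⁺ (Unique.map⁺ ∷ᵛ-injectiveʳ (Unique-allSubsets n)) (Unique.map⁺ ∷ᵛ-injectiveʳ (Unique-allSubsets n)) disjoint
    where
    disjoint : Disjoint (map (true ∷_) (allSubsets n)) (map (false ∷_) (allSubsets n))
    disjoint (p , q) with ∈-map⁻ (true ∷_) p | ∈-map⁻ (false ∷_) q
    ... | _ , _ , refl | _ , _ , ()

  length-allSubsets : (n : ℕ) → length (allSubsets n) ≡ 2 ^ n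
  length-allSubsets zero = refl
  length-allSubsets (suc n) = begin
    length (map (true ∷_) (allSubsets n) ++ map (false ∷_) (allSubsets n))
      ≡⟨ length-++ (map (true ∷_) (allSubsets n)) ⟩
    length (map (true ∷_) (allSubsets n)) + length (map (false ∷_) (allSubsets n))
      ≡⟨ cong₂ _+_ (length-map (true ∷_) (allSubsets n)) (length-map (false ∷_) (allSubsets n)) ⟩
    length (allSubsets n) + length (allSubsets n)
      ≡⟨ cong (λ m → m + m) (length-allSubsets n) ⟩
    2 ^ n + 2 ^ n
      ≡⟨ cong (2 ^ n +_) (sym (+-identityʳ (2 ^ n))) ⟩
    2 ^ suc n ∎
    where open ≡-Reasoning

  count-allSubsets-suc : {n : ℕ} {P : Pred (Subset (suc n)) 0ℓ} (P? : Decidable P) →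
                         count P? (allSubsets (suc n)) ≡
                         count (λ A → P? (true ∷ A)) (allSubsets n) + count (λ A → P? (false ∷ A)) (allSubsets n)
  count-allSubsets-suc {n} P? = trans (count-++ P? (map (true ∷_) (allSubsets n)) _)
                                      (cong₂ _+_ (count-map P? (true ∷_) (allSubsets n)) (count-map P? (false ∷_) (allSubsets n)))

  module _ {B : Set} (g : B → ℕ) where

    ≤-maxℕ : {x : B} {xs : List B} → x ∈ xs → g x ≤ maxℕ (map g xs)
    ≤-maxℕ (here refl) = m≤m⊔n _ _
    ≤-maxℕ {xs = y ∷ _} (there x∈) = ≤-trans (≤-maxℕ x∈) (m≤n⊔m (g y) _)

    maxℕ-attained : (xs : List B) → maxℕ (map g xs) ≡ 0 ⊎ ∃ λ x → x ∈ xs × maxℕ (map g xs) ≡ g x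
    maxℕ-attained xs with foldr-selective ⊔-sel 0 (map g xs)
    ... | inj₁ max≡0 = inj₁ max≡0
    ... | inj₂ max∈  = inj₂ (∈-map⁻ g max∈)

  sum-map-+ : {A : Set} (g h : A → ℕ) (xs : List A) → sum (map (λ x → g x + h x) xs) ≡ sum (map g xs) + sum (map h xs)
  sum-map-+ g h []       = refl
  sum-map-+ g h (x ∷ xs) = trans (cong (g x + h x +_) (sum-map-+ g h xs)) (+-interchange (g x) (h x) _ _)

  sum-map-0 : {A : Set} (xs : List A) → sum (map (λ _ → 0) xs) ≡ 0
  sum-map-0 []       = refl
  sum-map-0 (x ∷ xs) = sum-map-0 xs

  select : {X : Set} {n : ℕ} → Vec X n → Subset n → List X
  select []         []          = []
  select (u ∷ cols) (true ∷ A)  = u ∷ select cols A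
  select (u ∷ cols) (false ∷ A) = select cols A

  length-select : {X : Set} {n : ℕ} (cols : Vec X n) (A : Subset n) → ∣ A ∣ ≡ length (select cols A)
  length-select []         []          = refl
  length-select (u ∷ cols) (true ∷ A)  = cong suc (length-select cols A)
  length-select (u ∷ cols) (false ∷ A) = length-select cols A

  module Enumeration {X : Set} (_≟_ : DecidableEquality X) where

    open import Data.List.Membership.DecPropositional _≟_ using (_∈?_)
    open import Data.List.Relation.Binary.Subset.DecPropositional _≟_ using (_⊆?_)
    open import Data.List.Relation.Unary.Unique.DecPropositional _≟_ using (unique?)
    open ≡-Reasoning

    _enumerates_ : List X → List X → Set
    L enumerates e = Unique L × L ⊆ₗ e × e ⊆ₗ L

    _enumerates?_ : (L e : List X) → Dec (L enumerates e)
    L enumerates? e = unique? L ×-dec (L ⊆? e ×-dec e ⊆? L)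

    δ : X → X → ℕ
    δ u v with u ≟ v
    ... | yes _ = 1
    ... | no _  = 0

    δ-refl : ∀ u → δ u u ≡ 1
    δ-refl u with u ≟ u
    ... | yes _ = refl
    ... | no u≢u = ⊥-elim (u≢u refl)

    δ-≢ : ∀ {u v} → u ≢ v → δ u v ≡ 0
    δ-≢ {u} {v} u≢v with u ≟ v
    ... | yes u≡v = ⊥-elim (u≢v u≡v)
    ... | no _    = refl

    multiplicity : List X → X → ℕ
    multiplicity []       v = 0
    multiplicity (u ∷ us) v = δ u v + multiplicity us v

    remove : X → List X → List X
    remove u = filter (λ v → ¬? (u ≟ v))

    remove-∉ : ∀ {u} e → u ∉ e → remove u e ≡ e
    remove-∉ {u} e u∉e = filter-all (λ v → ¬? (u ≟ v)) (All.tabulate λ { v∈e refl → u∉e v∈e })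

    ∷-enumerates⇒enumerates-remove : ∀ {u L e} → (u ∷ L) enumerates e → L enumerates (remove u e)
    ∷-enumerates⇒enumerates-remove {u} {L} {e} (u∉L ∷ uniqueL , uL⊆e , e⊆uL) = uniqueL , L⊆ , ⊆L
      where
      L⊆ : L ⊆ₗ remove u e
      L⊆ z∈L = ∈-filter⁺ (λ v → ¬? (u ≟ v)) (uL⊆e (there z∈L)) (All.lookup u∉L z∈L)
      ⊆L : remove u e ⊆ₗ L
      ⊆L z∈ with ∈-filter⁻ (λ v → ¬? (u ≟ v)) {xs = e} z∈
      ... | z∈e , u≢z with e⊆uL z∈e
      ...   | here refl = ⊥-elim (u≢z refl)
      ...   | there z∈L = z∈L

    enumerates-remove⇒∷-enumerates : ∀ {u L e} → u ∈ e → L enumerates (remove u e) → (u ∷ L) enumerates e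
    enumerates-remove⇒∷-enumerates {u} {L} {e} u∈e (uniqueL , L⊆ , ⊆L) =
      All.tabulate (λ z∈L → proj₂ (removed z∈L)) ∷ uniqueL , uL⊆e , e⊆uL
      where
      removed : ∀ {z} → z ∈ L → z ∈ e × u ≢ z
      removed z∈L = ∈-filter⁻ (λ v → ¬? (u ≟ v)) {xs = e} (L⊆ z∈L)
      uL⊆e : u ∷ L ⊆ₗ e
      uL⊆e (here refl) = u∈e
      uL⊆e (there z∈L) = proj₁ (removed z∈L)
      e⊆uL : e ⊆ₗ u ∷ L
      e⊆uL {z} z∈e with u ≟ z
      ... | yes refl = here refl
      ... | no u≢z   = there (⊆L (∈-filter⁺ (λ v → ¬? (u ≟ v)) z∈e u≢z))

    module _ (c : X → ℕ) (u : X) where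

      product-δ-∉ : ∀ e → u ∉ e → product (map (λ v → δ u v + c v) e) ≡ product (map c e)
      product-δ-∉ [] _ = refl
      product-δ-∉ (v ∷ e) u∉ =
        cong₂ _*_ (cong (_+ c v) (δ-≢ λ { refl → u∉ (here refl) })) (product-δ-∉ e (λ u∈ → u∉ (there u∈)))

      product-δ-∈ : ∀ e → Unique e → u ∈ e →
                    product (map (λ v → δ u v + c v) e) ≡ product (map c (remove u e)) + product (map c e)
      product-δ-∈ (v ∷ e) (v∉e ∷ _) (here refl) = begin
        (δ u u + c u) * product (map (λ v → δ u v + c v) e)
          ≡⟨ cong₂ (λ a b → (a + c u) * b) (δ-refl u) (product-δ-∉ e u∉e) ⟩
        product (map c e) + c u * product (map c e)
          ≡⟨ cong (λ l → product (map c l) + c u * product (map c e)) (sym (remove-∉ e u∉e)) ⟩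
        product (map c (remove u e)) + product (map c (u ∷ e))
          ≡⟨ cong (λ l → product (map c l) + product (map c (u ∷ e)))
                  (sym (filter-reject (λ v → ¬? (u ≟ v)) {xs = e} (λ u≢u → u≢u refl))) ⟩
        product (map c (remove u (u ∷ e))) + product (map c (u ∷ e)) ∎
        where
        u∉e : u ∉ e
        u∉e u∈e = All.lookup v∉e u∈e refl
      product-δ-∈ (v ∷ e) (v∉e ∷ unique) (there u∈e) = begin
        (δ u v + c v) * product (map (λ v → δ u v + c v) e)
          ≡⟨ cong₂ (λ a b → (a + c v) * b) (δ-≢ u≢v) (product-δ-∈ e unique u∈e) ⟩
        c v * (product (map c (remove u e)) + product (map c e))
          ≡⟨ *-distribˡ-+ (c v) (product (map c (remove u e))) _ ⟩
        product (map c (v ∷ remove u e)) + product (map c (v ∷ e))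
          ≡⟨ cong (λ l → product (map c l) + product (map c (v ∷ e))) (sym (filter-accept (λ v → ¬? (u ≟ v)) u≢v)) ⟩
        product (map c (remove u (v ∷ e))) + product (map c (v ∷ e)) ∎
        where
        u≢v : u ≢ v
        u≢v refl = All.lookup v∉e u∈e refl

    -- Such an S picks, for each v ∈ e, one of the multiplicity v columns equal to v.
    count-select-enumerates : {n : ℕ} (cols : Vec X n) (e : List X) → Unique e →
                              count (λ S → select cols S enumerates? e) (allSubsets n) ≡
                              product (map (multiplicity (toList cols)) e)
    count-select-enumerates [] [] _ = refl
    count-select-enumerates [] (v ∷ e) _ with [] enumerates? (v ∷ e)
    ... | yes (_ , _ , v∈[]) with v∈[] (here refl)
    ...   | ()
    count-select-enumerates [] (v ∷ e) _ | no _ = refl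
    count-select-enumerates {suc n} (u ∷ cols) e unique with u ∈? e
    ... | yes u∈e = begin
      count (λ S → select (u ∷ cols) S enumerates? e) (allSubsets (suc n))
        ≡⟨ count-allSubsets-suc (λ S → select (u ∷ cols) S enumerates? e) ⟩
      count (λ S → (u ∷ select cols S) enumerates? e) (allSubsets n) + count (λ S → select cols S enumerates? e) (allSubsets n)
        ≡⟨ cong (_+ count (λ S → select cols S enumerates? e) (allSubsets n))
                (count-≐ (λ S → (u ∷ select cols S) enumerates? e) (λ S → select cols S enumerates? remove u e)
                         (∷-enumerates⇒enumerates-remove , enumerates-remove⇒∷-enumerates u∈e) (allSubsets n)) ⟩
      count (λ S → select cols S enumerates? remove u e) (allSubsets n) + count (λ S → select cols S enumerates? e) (allSubsets n)
        ≡⟨ cong₂ _+_ (count-select-enumerates cols (remove u e) (Unique.filter⁺ (λ v → ¬? (u ≟ v)) unique))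
                     (count-select-enumerates cols e unique) ⟩
      product (map (multiplicity (toList cols)) (remove u e)) + product (map (multiplicity (toList cols)) e)
        ≡⟨ sym (product-δ-∈ (multiplicity (toList cols)) u e unique u∈e) ⟩
      product (map (multiplicity (toList (u ∷ cols))) e) ∎
    ... | no u∉e = begin
      count (λ S → select (u ∷ cols) S enumerates? e) (allSubsets (suc n))
        ≡⟨ count-allSubsets-suc (λ S → select (u ∷ cols) S enumerates? e) ⟩
      count (λ S → (u ∷ select cols S) enumerates? e) (allSubsets n) + count (λ S → select cols S enumerates? e) (allSubsets n)
        ≡⟨ cong₂ _+_ (count-none (λ S → (u ∷ select cols S) enumerates? e)
                                 (λ { _ (_ , uL⊆e , _) → u∉e (uL⊆e (here refl)) }) (allSubsets n))
                     (count-select-enumerates cols e unique) ⟩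
      product (map (multiplicity (toList cols)) e)
        ≡⟨ sym (product-δ-∉ (multiplicity (toList cols)) u e u∉e) ⟩
      product (map (multiplicity (toList (u ∷ cols))) e) ∎

    enumerates⇒length≡ : ∀ {L e} → Unique e → L enumerates e → length L ≡ length e
    enumerates⇒length≡ unique-e (unique-L , L⊆e , e⊆L) = ≤-antisym (Unique⇒length≤ unique-L L⊆e) (Unique⇒length≤ unique-e e⊆L)

    sum-δ-∉ : ∀ {u} vs → u ∉ vs → sum (map (δ u) vs) ≡ 0
    sum-δ-∉ []       _   = refl
    sum-δ-∉ (v ∷ vs) u∉ = cong₂ _+_ (δ-≢ λ { refl → u∉ (here refl) }) (sum-δ-∉ vs (λ u∈ → u∉ (there u∈)))

    sum-δ-∈ : ∀ {u} vs → Unique vs → u ∈ vs → sum (map (δ u) vs) ≡ 1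
    sum-δ-∈ {u} (v ∷ vs) (v∉vs ∷ _) (here refl) = cong₂ _+_ (δ-refl u) (sum-δ-∉ vs λ u∈ → All.lookup v∉vs u∈ refl)
    sum-δ-∈ {u} (v ∷ vs) (v∉vs ∷ unique) (there u∈) = cong₂ _+_ (δ-≢ λ { refl → All.lookup v∉vs u∈ refl }) (sum-δ-∈ vs unique u∈)

    sum-multiplicity : ∀ {vs} → Unique vs → (l : List X) → l ⊆ₗ vs → sum (map (multiplicity l) vs) ≡ length l
    sum-multiplicity {vs} _ [] _ = sum-map-0 vs
    sum-multiplicity {vs} unique (u ∷ l) ul⊆vs = begin
      sum (map (λ v → δ u v + multiplicity l v) vs)
        ≡⟨ sum-map-+ (δ u) (multiplicity l) vs ⟩
      sum (map (δ u) vs) + sum (map (multiplicity l) vs)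
        ≡⟨ cong₂ _+_ (sum-δ-∈ vs unique (ul⊆vs (here refl))) (sum-multiplicity unique l (λ v∈ → ul⊆vs (there v∈))) ⟩
      suc (length l) ∎

    expand : (X → ℕ) → List X → List X
    expand m []       = []
    expand m (v ∷ vs) = List.replicate (m v) v ++ expand m vs

    length-expand : (m : X → ℕ) (vs : List X) → length (expand m vs) ≡ sum (map m vs)
    length-expand m []       = refl
    length-expand m (v ∷ vs) = trans (length-++ (List.replicate (m v) v)) (cong₂ _+_ (length-replicate (m v)) (length-expand m vs))

    multiplicity-++ : (l l′ : List X) (v : X) → multiplicity (l ++ l′) v ≡ multiplicity l v + multiplicity l′ v
    multiplicity-++ []      l′ v = refl
    multiplicity-++ (u ∷ l) l′ v = trans (cong (δ u v +_) (multiplicity-++ l l′ v)) (sym (+-assoc (δ u v) _ _))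

    multiplicity-replicate : (r : ℕ) (v : X) → multiplicity (List.replicate r v) v ≡ r
    multiplicity-replicate zero    v = refl
    multiplicity-replicate (suc r) v = cong₂ _+_ (δ-refl v) (multiplicity-replicate r v)

    multiplicity-expand : (m : X → ℕ) (vs : List X) {v : X} → v ∈ vs → m v ≤ multiplicity (expand m vs) v
    multiplicity-expand m (u ∷ vs) {v} v∈ rewrite multiplicity-++ (List.replicate (m u) u) (expand m vs) v with v∈
    ... | here refl = ≤-trans (≤-reflexive (sym (multiplicity-replicate (m u) u))) (m≤m+n _ _)
    ... | there v∈vs = ≤-trans (multiplicity-expand m vs v∈vs) (m≤n+m _ _)

    pad : X → List X → (n : ℕ) → Vec X n
    pad x l        zero    = []
    pad x []       (suc n) = x ∷ pad x [] n
    pad x (u ∷ l) (suc n) = u ∷ pad x l n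

    multiplicity-pad : (x : X) (l : List X) (n : ℕ) → length l ≤ n → ∀ v → multiplicity l v ≤ multiplicity (toList (pad x l n)) v
    multiplicity-pad x []      n       _              v = z≤n
    multiplicity-pad x (u ∷ l) (suc n) (s≤s length≤n) v = +-monoʳ-≤ (δ u v) (multiplicity-pad x l n length≤n v)

  module Labelling {X : Set} (_≟_ : DecidableEquality X) where

    module _ (g h : X → Bool) where

      ∩-≡⇒All-select : {n : ℕ} (cols : Vec X n) (A : Subset n) →
                       Vec.map g cols ∩ A ≡ Vec.map h cols ∩ A → All (λ v → g v ≡ h v) (select cols A)
      ∩-≡⇒All-select []         []          _  = []
      ∩-≡⇒All-select (u ∷ cols) (true ∷ A)  eq =
        trans (sym (∧-identityʳ (g u))) (trans (cong Vec.head eq) (∧-identityʳ (h u)))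
        ∷ ∩-≡⇒All-select cols A (cong Vec.tail eq)
      ∩-≡⇒All-select (u ∷ cols) (false ∷ A) eq = ∩-≡⇒All-select cols A (cong Vec.tail eq)

      All-select⇒∩-≡ : {n : ℕ} (cols : Vec X n) (A : Subset n) →
                       All (λ v → g v ≡ h v) (select cols A) → Vec.map g cols ∩ A ≡ Vec.map h cols ∩ A
      All-select⇒∩-≡ []         []          _          = refl
      All-select⇒∩-≡ (u ∷ cols) (true ∷ A)  (gu≡hu ∷ eqs) = cong₂ _∷_ (cong (_∧ true) gu≡hu) (All-select⇒∩-≡ cols A eqs)
      All-select⇒∩-≡ (u ∷ cols) (false ∷ A) eqs =
        cong₂ _∷_ (trans (∧-zeroʳ (g u)) (sym (∧-zeroʳ (h u)))) (All-select⇒∩-≡ cols A eqs)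

    update : (X → Bool) → X → Bool → X → Bool
    update β u b v with u ≟ v
    ... | yes _ = b
    ... | no _  = β v

    update-≡ : ∀ β u b → update β u b u ≡ b
    update-≡ β u b with u ≟ u
    ... | yes _  = refl
    ... | no u≢u = ⊥-elim (u≢u refl)

    update-≢ : ∀ β {u v} b → u ≢ v → update β u b v ≡ β v
    update-≢ β {u} {v} b u≢v with u ≟ v
    ... | yes u≡v = ⊥-elim (u≢v u≡v)
    ... | no _    = refl

    labelling-of-vector : (e : List X) → Unique e → (w : Vec Bool (length e)) → ∃ λ β → map β e ≡ toList w
    labelling-of-vector []      _                [] = (λ _ → false) , refl
    labelling-of-vector (u ∷ e) (u∉e ∷ unique) (b ∷ w) with labelling-of-vector e unique w
    ... | β , βe≡w = update β u b , cong₂ _∷_ (update-≡ β u b) (trans (map-cong-local (All.map (update-≢ β b) u∉e)) βe≡w)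

    labelling-of-subset : {n : ℕ} (cols : Vec X n) {A A′ : Subset n} → Unique (select cols A) → A′ ⊆ A →
                          ∃ λ β → Vec.map β cols ∩ A ≡ A′
    labelling-of-subset [] {[]} {[]} _ _ = (λ _ → false) , refl
    labelling-of-subset (u ∷ cols) {true ∷ A} {b ∷ A′} (u∉ ∷ unique) A′⊆A
      with labelling-of-subset cols unique (drop-∷-⊆ A′⊆A)
    ... | β , β-A≡A′ = update β u b , cong₂ _∷_ (trans (∧-identityʳ _) (update-≡ β u b))
                         (trans (All-select⇒∩-≡ (update β u b) β cols A (All.map (update-≢ β b) u∉)) β-A≡A′)
    labelling-of-subset (u ∷ cols) {false ∷ A} {true ∷ A′} _ A′⊆A with A′⊆A Vec.here
    ... | ()
    labelling-of-subset (u ∷ cols) {false ∷ A} {false ∷ A′} unique A′⊆A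
      with labelling-of-subset cols unique (drop-∷-⊆ A′⊆A)
    ... | β , β-A≡A′ = β , cong₂ _∷_ (∧-zeroʳ (β u)) β-A≡A′

  lookupClamped : {A : Set} → A → List A → ℕ → A
  lookupClamped x []       _       = x
  lookupClamped x (y ∷ ys) zero    = x
  lookupClamped x (y ∷ ys) (suc m) = lookupClamped y ys m

  lookupClamped-∈ : {A : Set} (x : A) (xs : List A) (m : ℕ) → lookupClamped x xs m ∈ x ∷ xs
  lookupClamped-∈ x []       _       = here refl
  lookupClamped-∈ x (y ∷ ys) zero    = here refl
  lookupClamped-∈ x (y ∷ ys) (suc m) = there (lookupClamped-∈ y ys m)

  lookupClamped-surjective : {A : Set} {x z : A} {xs : List A} → z ∈ x ∷ xs → ∃ λ m → m < length (x ∷ xs) × lookupClamped x xs m ≡ z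
  lookupClamped-surjective {xs = []}     (here refl) = 0 , s≤s z≤n , refl
  lookupClamped-surjective {xs = _ ∷ _}  (here refl) = 0 , s≤s z≤n , refl
  lookupClamped-surjective {xs = _ ∷ _}  (there z∈)  with lookupClamped-surjective z∈
  ... | m , m<len , eq = suc m , s≤s m<len , eq

  edgePoly : {X : Set} → List (List X) → (X → ℕ) → ℕ
  edgePoly E c = sum (map (λ e → product (map c e)) E)

  module _ {X : Set} {c c′ : X → ℕ} (c≤c′ : ∀ v → c v ≤ c′ v) where

    product-map-mono : ∀ e → product (map c e) ≤ product (map c′ e)
    product-map-mono []      = ≤-refl
    product-map-mono (v ∷ e) = *-mono-≤ (c≤c′ v) (product-map-mono e)

    edgePoly-mono : ∀ E → edgePoly E c ≤ edgePoly E c′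
    edgePoly-mono []      = z≤n
    edgePoly-mono (e ∷ E) = +-mono-≤ (product-map-mono e) (edgePoly-mono E)

  ≤-edgePoly : {X : Set} (c : X → ℕ) {e : List X} {E : List (List X)} → e ∈ E → product (map c e) ≤ edgePoly E c
  ≤-edgePoly c (here refl) = m≤m+n _ _
  ≤-edgePoly c {E = e′ ∷ _} (there e∈) = ≤-trans (≤-edgePoly c e∈) (m≤n+m _ (product (map c e′)))

  product-const : {X : Set} (t : ℕ) (e : List X) → product (map (λ _ → t) e) ≡ t ^ length e
  product-const t []      = refl
  product-const t (_ ∷ e) = cong (t *_) (product-const t e)

  sum-const : {X : Set} (t : ℕ) (xs : List X) → sum (map (λ _ → t) xs) ≡ length xs * t
  sum-const t []      = refl
  sum-const t (_ ∷ xs) = cong (t +_) (sum-const t xs)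

  *-^-distrib : ∀ a b d → (a * b) ^ d ≡ a ^ d * b ^ d
  *-^-distrib a b zero    = refl
  *-^-distrib a b (suc d) = trans (cong (a * b *_) (*-^-distrib a b d)) (*-interchange a b (a ^ d) (b ^ d))

  -- With n ≥ q ≥ 1 and t = ⌊n / q⌋ we have n < q + t q ≤ 2 q t.
  ≤-2*[n/q] : ∀ n q .{{_ : ℕ.NonZero q}} → q ≤ n → n ≤ 2 * q * (n / q)
  ≤-2*[n/q] n q q≤n = begin
    n                         ≡⟨ m≡m%n+[m/n]*n n q ⟩
    n % q + n / q * q         ≤⟨ +-monoˡ-≤ (n / q * q) (<⇒≤ (<-≤-trans (m%n<n n q) q≤[n/q]*q)) ⟩
    n / q * q + n / q * q     ≡⟨ cong (n / q * q +_) (sym (+-identityʳ (n / q * q))) ⟩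
    2 * (n / q * q)           ≡⟨ cong (2 *_) (*-comm (n / q) q) ⟩
    2 * (q * (n / q))         ≡⟨ sym (*-assoc 2 q (n / q)) ⟩
    2 * q * (n / q)           ∎
    where
    open ≤-Reasoning
    q≤[n/q]*q : q ≤ n / q * q
    q≤[n/q]*q = m≤n*m q (n / q) {{>-nonZero (m≥n⇒m/n>0 q≤n)}}

open Counting

module BlowUp {k : ℕ} where

  open import Data.Nat using (_+_; _*_; _≟_)

  open Enumeration {Vertex k} (≡-dec _≟ᴮ_)
  open Labelling {Vertex k} (≡-dec _≟ᴮ_)
  open import Data.List.Membership.DecPropositional {A = Vertex k} (≡-dec _≟ᴮ_) using (_∈?_)

  rowOf : {n : ℕ} → Vec (Vertex k) n → Fin k → Subset n
  rowOf cols j = Vec.map (λ v → Vec.lookup v j) cols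

  RowsShatter : {n : ℕ} → Vec (Vertex k) n → Subset n → Set
  RowsShatter cols A = ∀ {A′} → A′ ⊆ A → ∃ λ j → rowOf cols j ∩ A ≡ A′

  AllLabellingsAreRows : List (Vertex k) → Set
  AllLabellingsAreRows L = (β : Vertex k → Bool) → ∃ λ j → All (λ v → Vec.lookup v j ≡ β v) L

  AllLabellingsAreRows-⊆ : ∀ {L e} → e ⊆ₗ L → AllLabellingsAreRows L → AllLabellingsAreRows e
  AllLabellingsAreRows-⊆ e⊆L rows β with rows β
  ... | j , agree = j , All.tabulate (λ v∈e → All.lookup agree (e⊆L v∈e))

  RowsShatter-tail : ∀ {n u b} {cols : Vec (Vertex k) n} {A} → RowsShatter (u ∷ cols) (b ∷ A) → RowsShatter cols A
  RowsShatter-tail shatter A′⊆A with shatter (out⊆ A′⊆A)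
  ... | j , eq = j , cong Vec.tail eq

  RowsShatter⇒Unique : {n : ℕ} (cols : Vec (Vertex k) n) (A : Subset n) → RowsShatter cols A → Unique (select cols A)
  RowsShatter⇒Unique []         []          _       = []
  RowsShatter⇒Unique (u ∷ cols) (false ∷ A) shatter = RowsShatter⇒Unique cols A (RowsShatter-tail {u = u} shatter)
  RowsShatter⇒Unique (u ∷ cols) (true ∷ A)  shatter = u∉ ∷ RowsShatter⇒Unique cols A (RowsShatter-tail {u = u} shatter)
    where
    -- A row that is 1 on the column u and 0 on the rest of A separates u from the other columns in A.
    u∉ : All (u ≢_) (select cols A)
    u∉ with shatter (s⊆s ⊥⊆)
    ... | j , eq = All.tabulate λ { z∈ refl →
                     true≢false (trans (sym (cong Vec.head eq)) (trans (∧-identityʳ _) (All.lookup zero-on-A z∈))) }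
      where
      zero-on-A : All (λ v → Vec.lookup v j ≡ false) (select cols A)
      zero-on-A = ∩-≡⇒All-select (λ v → Vec.lookup v j) (λ _ → false) cols A
                    (trans (cong Vec.tail eq) (sym (trans (cong (_∩ A) (map-const cols false)) (∩-zeroˡ A))))
      true≢false : true ≡ false → ⊥
      true≢false ()

  RowsShatter⇒AllLabellingsAreRows : {n : ℕ} (cols : Vec (Vertex k) n) (A : Subset n) →
                                     RowsShatter cols A → AllLabellingsAreRows (select cols A)
  RowsShatter⇒AllLabellingsAreRows cols A shatter β with shatter (p∩q⊆q (Vec.map β cols) A)
  ... | j , eq = j , ∩-≡⇒All-select (λ v → Vec.lookup v j) β cols A eq

  AllLabellingsAreRows⇒RowsShatter : {n : ℕ} (cols : Vec (Vertex k) n) (A : Subset n) →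
                                     Unique (select cols A) → AllLabellingsAreRows (select cols A) → RowsShatter cols A
  AllLabellingsAreRows⇒RowsShatter cols A unique rows A′⊆A with labelling-of-subset cols unique A′⊆A
  ... | β , β-A≡A′ with rows β
  ...   | j , agree = j , trans (All-select⇒∩-≡ (λ v → Vec.lookup v j) β cols A agree) β-A≡A′

  ShatteredMatrix⇒AllLabellingsAreRows : (e : List (Vertex k)) → ShatteredMatrix e → AllLabellingsAreRows e
  ShatteredMatrix⇒AllLabellingsAreRows e shattered β
    with find (All.lookup shattered (subst (_∈ map toList (allSubsets (length e))) toList-βe
                                           (∈-map⁺ toList (∈-allSubsets (Vec.map β (Vec.fromList e))))))
    where
    toList-βe : toList (Vec.map β (Vec.fromList e)) ≡ map β e
    toList-βe = trans (toList-map β (Vec.fromList e)) (cong (map β) (toList∘fromList e))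
  ... | j , _ , row≡βe = j , map-≡⇒All e row≡βe
    where
    map-≡⇒All : ∀ e → map (λ v → Vec.lookup v j) e ≡ map β e → All (λ v → Vec.lookup v j ≡ β v) e
    map-≡⇒All []      _  = []
    map-≡⇒All (v ∷ e) eq = ∷-injectiveˡ eq ∷ map-≡⇒All e (∷-injectiveʳ eq)

  AllLabellingsAreRows⇒ShatteredMatrix : (e : List (Vertex k)) → Unique e → AllLabellingsAreRows e → ShatteredMatrix e
  AllLabellingsAreRows⇒ShatteredMatrix e unique rows = All.tabulate row-for
    where
    row-for : ∀ {w} → w ∈ map toList (allSubsets (length e)) → Any (λ i → row e i ≡ w) (List.allFin k)
    row-for w∈ with ∈-map⁻ toList w∈
    ... | w , _ , refl with labelling-of-vector e unique w
    ...   | β , βe≡w with rows β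
    ...     | j , agree = Any.map (λ { refl → trans (map-cong-local agree) βe≡w }) (∈-allFin j)

  ∈-edges⁻ : ∀ {d e} → e ∈ edges k d → e ∈ sublists (allSubsets k) × ShatteredMatrix e × length e ≡ d
  ∈-edges⁻ {d} e∈ with ∈-filter⁻ (λ e → length e ≟ d) e∈
  ... | e∈′ , length≡d with ∈-filter⁻ shatteredMatrix? {xs = sublists (allSubsets k)} e∈′
  ...   | e∈″ , shattered = e∈″ , shattered , length≡d

  ∈-edges⁺ : ∀ {d e} → e ∈ sublists (allSubsets k) → ShatteredMatrix e → length e ≡ d → e ∈ edges k d
  ∈-edges⁺ {d} e∈ shattered length≡d = ∈-filter⁺ (λ e → length e ≟ d) (∈-filter⁺ shatteredMatrix? e∈ shattered) length≡d

  Unique-∈-edges : ∀ {d e} → e ∈ edges k d → Unique e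
  Unique-∈-edges e∈ = Unique-∈-sublists (Unique-allSubsets k) (proj₁ (∈-edges⁻ e∈))

  -- The columns of a shattered d-set, listed in the canonical order of allSubsets k, form an edge of H(k,d).
  RowsShatter⇒edge : ∀ {n d} (cols : Vec (Vertex k) n) (A : Subset n) → RowsShatter cols A → ∣ A ∣ ≡ d →
                     Any (select cols A enumerates_) (edges k d)
  RowsShatter⇒edge {d = d} cols A shatter ∣A∣≡d =
    Any.map (λ { refl → L-enumerates-e }) (∈-edges⁺ (filter∈sublists (_∈? L) (allSubsets k)) e-shattered length-e)
    where
    L : List (Vertex k)
    L = select cols A
    e : List (Vertex k)
    e = filter (_∈? L) (allSubsets k)
    unique-e : Unique e
    unique-e = Unique.filter⁺ (_∈? L) (Unique-allSubsets k)
    L-enumerates-e : L enumerates e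
    L-enumerates-e = RowsShatter⇒Unique cols A shatter
                   , (λ {v} v∈L → ∈-filter⁺ (_∈? L) (∈-allSubsets v) v∈L)
                   , (λ v∈e → proj₂ (∈-filter⁻ (_∈? L) {xs = allSubsets k} v∈e))
    e-shattered : ShatteredMatrix e
    e-shattered = AllLabellingsAreRows⇒ShatteredMatrix e unique-e
                    (AllLabellingsAreRows-⊆ (proj₂ (proj₂ L-enumerates-e)) (RowsShatter⇒AllLabellingsAreRows cols A shatter))
    length-e : length e ≡ d
    length-e = trans (sym (enumerates⇒length≡ unique-e L-enumerates-e)) (trans (sym (length-select cols A)) ∣A∣≡d)

  edge⇒RowsShatter : ∀ {n d} (cols : Vec (Vertex k) n) (A : Subset n) → Any (select cols A enumerates_) (edges k d) →
                     RowsShatter cols A × ∣ A ∣ ≡ d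
  edge⇒RowsShatter cols A L-enumerates-edge with find L-enumerates-edge
  ... | e , e∈ , L-enumerates-e@(unique-L , L⊆e , _) with ∈-edges⁻ e∈
  ...   | _ , e-shattered , length≡d =
          AllLabellingsAreRows⇒RowsShatter cols A unique-L
            (AllLabellingsAreRows-⊆ L⊆e (ShatteredMatrix⇒AllLabellingsAreRows e e-shattered))
        , trans (length-select cols A) (trans (enumerates⇒length≡ (Unique-∈-edges e∈) L-enumerates-e) length≡d)

  IsRowFamily : {n : ℕ} → List (Subset n) → Vec (Vertex k) n → Set
  IsRowFamily F cols = (∀ {G} → G ∈ F → ∃ λ j → rowOf cols j ≡ G) × (∀ j → rowOf cols j ∈ F)

  module _ {n : ℕ} {F : List (Subset n)} {cols : Vec (Vertex k) n} (rows : IsRowFamily F cols) where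

    Shatters⇒RowsShatter : ∀ A → Shatters F A → RowsShatter cols A
    Shatters⇒RowsShatter A shatters {A′} A′⊆A with find (All.lookup shatters (∈-allSubsets A′) A′⊆A)
    ... | G , G∈F , G∩A≡A′ with proj₁ rows G∈F
    ...   | j , refl = j , G∩A≡A′

    RowsShatter⇒Shatters : ∀ A → RowsShatter cols A → Shatters F A
    RowsShatter⇒Shatters A shatter = All.tabulate λ {A′} _ A′⊆A →
      let (j , row∩A≡A′) = shatter A′⊆A in Any.map (λ { refl → row∩A≡A′ }) (proj₂ rows j)

  Unique-edges : ∀ d → Unique (edges k d)
  Unique-edges d = Unique.filter⁺ _ (Unique.filter⁺ shatteredMatrix? (Unique-sublists (Unique-allSubsets k)))

  enumerates-edge-unique : ∀ {d L e e′} → e ∈ edges k d → e′ ∈ edges k d → L enumerates e → L enumerates e′ → e ≡ e′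
  enumerates-edge-unique e∈ e′∈ (_ , L⊆e , e⊆L) (_ , L⊆e′ , e′⊆L) =
    sublists-≡ (Unique-allSubsets k) (proj₁ (∈-edges⁻ e∈)) (proj₁ (∈-edges⁻ e′∈))
               (λ v∈ → L⊆e′ (e⊆L v∈)) (λ v∈ → L⊆e (e′⊆L v∈))

  numShattered≡edgePoly : ∀ {n d} {F : List (Subset n)} {cols : Vec (Vertex k) n} → IsRowFamily F cols →
                          numShattered d F ≡ edgePoly (edges k d) (multiplicity (toList cols))
  numShattered≡edgePoly {n} {d} {F} {cols} rows = begin
    count (shatters? F) (filter (λ A → ∣ A ∣ ≟ d) (allSubsets n))
      ≡⟨ count-filter (shatters? F) (λ A → ∣ A ∣ ≟ d) (allSubsets n) ⟩
    count ((λ A → ∣ A ∣ ≟ d) ∩? shatters? F) (allSubsets n)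
      ≡⟨ count-≐ ((λ A → ∣ A ∣ ≟ d) ∩? shatters? F) enumerates-some-edge? (shattered⇒edge , edge⇒shattered) (allSubsets n) ⟩
    count enumerates-some-edge? (allSubsets n)
      ≡⟨ count-any (λ A e → select cols A enumerates? e) (edges k d) (Unique-edges d)
                   (λ e∈ e′∈ → enumerates-edge-unique e∈ e′∈) (allSubsets n) ⟩
    sum (map (λ e → count (λ A → select cols A enumerates? e) (allSubsets n)) (edges k d))
      ≡⟨ cong sum (map-cong-local (All.tabulate λ e∈ → count-select-enumerates cols _ (Unique-∈-edges e∈))) ⟩
    edgePoly (edges k d) (multiplicity (toList cols)) ∎
    where
    open ≡-Reasoning
    enumerates-some-edge? : Decidable (λ A → Any (select cols A enumerates_) (edges k d))
    enumerates-some-edge? A = any? (select cols A enumerates?_) (edges k d)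
    shattered⇒edge : ∀ {A} → ∣ A ∣ ≡ d × Shatters F A → Any (select cols A enumerates_) (edges k d)
    shattered⇒edge {A} (∣A∣≡d , shatters) = RowsShatter⇒edge cols A (Shatters⇒RowsShatter rows A shatters) ∣A∣≡d
    edge⇒shattered : ∀ {A} → Any (select cols A enumerates_) (edges k d) → ∣ A ∣ ≡ d × Shatters F A
    edge⇒shattered {A} enum with edge⇒RowsShatter cols A enum
    ... | shatter , ∣A∣≡d = ∣A∣≡d , RowsShatter⇒Shatters rows A shatter

  isRow? : {n : ℕ} (cols : Vec (Vertex k) n) → Decidable (λ G → Any (λ j → rowOf cols j ≡ G) (List.allFin k))
  isRow? cols G = any? (λ j → ≡-dec _≟ᴮ_ (rowOf cols j) G) (List.allFin k)

  rowFamily : {n : ℕ} → Vec (Vertex k) n → List (Subset n)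
  rowFamily {n} cols = filter (isRow? cols) (allSubsets n)

  rowFamily-IsRowFamily : {n : ℕ} (cols : Vec (Vertex k) n) → IsRowFamily (rowFamily cols) cols
  rowFamily-IsRowFamily {n} cols = row-of , row∈
    where
    row-of : ∀ {G} → G ∈ rowFamily cols → ∃ λ j → rowOf cols j ≡ G
    row-of G∈ with find (proj₂ (∈-filter⁻ (isRow? cols) {xs = allSubsets n} G∈))
    ... | j , _ , row≡G = j , row≡G
    row∈ : ∀ j → rowOf cols j ∈ rowFamily cols
    row∈ j = ∈-filter⁺ (isRow? cols) (∈-allSubsets (rowOf cols j)) (Any.map (λ { refl → refl }) (∈-allFin j))

  rowFamily∈families : {n : ℕ} (cols : Vec (Vertex k) n) → rowFamily cols ∈ families n k
  rowFamily∈families {n} cols = ∈-filter⁺ (λ F → length F ≤? k) (filter∈sublists _ (allSubsets n)) (begin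
    length (rowFamily cols)
      ≤⟨ Unique⇒length≤ (Unique.filter⁺ (isRow? cols) (Unique-allSubsets n)) G∈rows ⟩
    length (map (rowOf cols) (List.allFin k))
      ≡⟨ trans (length-map (rowOf cols) (List.allFin k)) (length-tabulate (λ j → j)) ⟩
    k ∎)
    where
    open ≤-Reasoning
    G∈rows : rowFamily cols ⊆ₗ map (rowOf cols) (List.allFin k)
    G∈rows G∈ with proj₁ (rowFamily-IsRowFamily cols) G∈
    ... | j , refl = ∈-map⁺ (rowOf cols) (∈-allFin j)

  edgePoly-multiplicity≤f : ∀ {n} d (cols : Vec (Vertex k) n) → edgePoly (edges k d) (multiplicity (toList cols)) ≤ f n k d
  edgePoly-multiplicity≤f {n} d cols =
    subst (_≤ f n k d) (numShattered≡edgePoly (rowFamily-IsRowFamily cols)) (≤-maxℕ (numShattered d) (rowFamily∈families cols))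

  colsWithRows : {n : ℕ} → (Fin k → Subset n) → Vec (Vertex k) n
  colsWithRows R = Vec.tabulate (λ i → Vec.tabulate (λ j → Vec.lookup (R j) i))

  rowOf-colsWithRows : {n : ℕ} (R : Fin k → Subset n) (j : Fin k) → rowOf (colsWithRows R) j ≡ R j
  rowOf-colsWithRows R j = begin
    Vec.map (λ v → Vec.lookup v j) (Vec.tabulate (λ i → Vec.tabulate (λ j → Vec.lookup (R j) i)))
      ≡⟨ sym (tabulate-∘ (λ v → Vec.lookup v j) _) ⟩
    Vec.tabulate (λ i → Vec.lookup (Vec.tabulate (λ j → Vec.lookup (R j) i)) j)
      ≡⟨ tabulate-cong (λ i → lookup∘tabulate (λ j → Vec.lookup (R j) i) j) ⟩
    Vec.tabulate (Vec.lookup (R j))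
      ≡⟨ tabulate∘lookup (R j) ⟩
    R j ∎
    where open ≡-Reasoning

  numShattered≤edgePoly : ∀ {n} d (F : List (Subset n)) → length F ≤ k →
                          ∃ λ (cols : Vec (Vertex k) n) → numShattered d F ≤ edgePoly (edges k d) (multiplicity (toList cols))
  numShattered≤edgePoly {n} d [] _ =
    Vec.replicate n (Vec.replicate k false) ,
    subst (_≤ edgePoly (edges k d) _) (sym (count-none (shatters? []) nothing-shattered (dSubsets n d))) z≤n
    where
    nothing-shattered : ∀ A → ¬ Shatters [] A
    nothing-shattered A shatters with All.lookup shatters (∈-allSubsets A) (λ x∈ → x∈)
    ... | ()
  numShattered≤edgePoly {n} d F@(G ∷ Gs) length≤k = cols , ≤-reflexive (numShattered≡edgePoly (rows-are-F , row∈F))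
    where
    R : Fin k → Subset n
    R j = lookupClamped G Gs (toℕ j)
    cols : Vec (Vertex k) n
    cols = colsWithRows R
    rows-are-F : ∀ {G′} → G′ ∈ F → ∃ λ j → rowOf cols j ≡ G′
    rows-are-F G′∈ with lookupClamped-surjective G′∈
    ... | m , m<len , eq = fromℕ< (≤-trans m<len length≤k)
                         , trans (rowOf-colsWithRows R _)
                                 (trans (cong (lookupClamped G Gs) (toℕ-fromℕ< (≤-trans m<len length≤k))) eq)
    row∈F : ∀ j → rowOf cols j ∈ F
    row∈F j = subst (_∈ F) (sym (rowOf-colsWithRows R j)) (lookupClamped-∈ G Gs (toℕ j))

  f≤edgePoly-multiplicity : ∀ n d → ∃ λ (cols : Vec (Vertex k) n) → f n k d ≤ edgePoly (edges k d) (multiplicity (toList cols))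
  f≤edgePoly-multiplicity n d with maxℕ-attained (numShattered d) (families n k)
  ... | inj₁ f≡0 = Vec.replicate n (Vec.replicate k false) , subst (_≤ edgePoly (edges k d) _) (sym f≡0) z≤n
  ... | inj₂ (F , F∈ , f≡)
    with numShattered≤edgePoly d F (proj₂ (∈-filter⁻ (λ F → length F ≤? k) {xs = sublists (allSubsets n)} F∈))
  ...   | cols , bound = cols , subst (_≤ edgePoly (edges k d) (multiplicity (toList cols))) (sym f≡) bound

  edgePoly≤f : ∀ {n} d (m : Vertex k → ℕ) → sum (map m (allSubsets k)) ≤ n → edgePoly (edges k d) m ≤ f n k d
  edgePoly≤f {n} d m sum≤n = ≤-trans (edgePoly-mono m≤multiplicity (edges k d)) (edgePoly-multiplicity≤f d cols)
    where
    vertices : List (Vertex k)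
    vertices = expand m (allSubsets k)
    cols : Vec (Vertex k) n
    cols = pad (Vec.replicate k false) vertices n
    m≤multiplicity : ∀ v → m v ≤ multiplicity (toList cols) v
    m≤multiplicity v = ≤-trans (multiplicity-expand m (allSubsets k) (∈-allSubsets v))
                               (multiplicity-pad _ vertices n (subst (_≤ n) (sym (length-expand m (allSubsets k))) sum≤n) v)

  -- Taking ⌊n / 2^k⌋ copies of every vertex shows f n k d ≥ ⌊n / 2^k⌋^d.
  pow≤f : ∀ {n d e} → e ∈ edges k d → 2 ^ k ≤ n → n ^ d ≤ (2 ^ suc k) ^ d * f n k d
  pow≤f {n} {d} {e} e∈ 2^k≤n = begin
    n ^ d                          ≤⟨ ^-monoˡ-≤ d (≤-2*[n/q] n (2 ^ k) 2^k≤n) ⟩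
    (2 ^ suc k * t) ^ d            ≡⟨ *-^-distrib (2 ^ suc k) t d ⟩
    (2 ^ suc k) ^ d * t ^ d        ≤⟨ *-monoʳ-≤ ((2 ^ suc k) ^ d) t^d≤f ⟩
    (2 ^ suc k) ^ d * f n k d      ∎
    where
    open ≤-Reasoning
    instance
      2^k≢0 : ℕ.NonZero (2 ^ k)
      2^k≢0 = m^n≢0 2 k
    t : ℕ
    t = n / 2 ^ k
    copies≤n : sum (map (λ _ → t) (allSubsets k)) ≤ n
    copies≤n = begin
      sum (map (λ _ → t) (allSubsets k))  ≡⟨ sum-const t (allSubsets k) ⟩
      length (allSubsets k) * t           ≡⟨ cong (_* t) (length-allSubsets k) ⟩
      2 ^ k * t                           ≡⟨ *-comm (2 ^ k) t ⟩
      t * 2 ^ k                           ≤⟨ m/n*n≤m n (2 ^ k) ⟩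
      n                                   ∎
    t^d≤f : t ^ d ≤ f n k d
    t^d≤f = begin
      t ^ d                                  ≡⟨ cong (t ^_) (sym (proj₂ (proj₂ (∈-edges⁻ e∈)))) ⟩
      t ^ length e                           ≡⟨ sym (product-const t e) ⟩
      product (map (λ _ → t) e)              ≤⟨ ≤-edgePoly (λ _ → t) e∈ ⟩
      edgePoly (edges k d) (λ _ → t)         ≤⟨ edgePoly≤f d (λ _ → t) copies≤n ⟩
      f n k d                                ∎

  rounding-error≤f : ∀ {n} d → 2 ^ k ≤ n →
                     length (edges k d) * (d * n ^ d) ≤ length (edges k d) * (d * (2 ^ suc k) ^ d) * f n k d
  rounding-error≤f {n} d 2^k≤n with edges k d in edges≡
  ... | []    = z≤n
  ... | e ∷ E = begin
    length (e ∷ E) * (d * n ^ d)                          ≤⟨ *-monoʳ-≤ (length (e ∷ E)) (*-monoʳ-≤ d (pow≤f e∈ 2^k≤n)) ⟩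
    length (e ∷ E) * (d * ((2 ^ suc k) ^ d * f n k d))    ≡⟨ cong (length (e ∷ E) *_) (sym (*-assoc d ((2 ^ suc k) ^ d) (f n k d))) ⟩
    length (e ∷ E) * (d * (2 ^ suc k) ^ d * f n k d)      ≡⟨ sym (*-assoc (length (e ∷ E)) (d * (2 ^ suc k) ^ d) (f n k d)) ⟩
    length (e ∷ E) * (d * (2 ^ suc k) ^ d) * f n k d      ∎
    where
    open ≤-Reasoning
    e∈ : e ∈ edges k d
    e∈ = subst (e ∈_) (sym edges≡) (here refl)

open BlowUp

import Data.Integer as ℤ
import Data.Integer.Properties as ℤ
open import Data.Nat.Coprimality using (1-coprimeTo) renaming (sym to coprime-sym)
import Data.Nat.Properties as ℕ
open import Data.Rational using (ℚ; mkℚ; 0ℚ; 1ℚ; _-_; -_; _+_; _*_; 1/_; *≤*; NonZero; Positive; nonNegative)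
  renaming (_≤_ to _≤ℚ_; _<_ to _<ℚ_)
import Data.Rational.Properties as ℚ
open import Data.Rational.Solver using (module +-*-Solver)
import Data.Rational.Unnormalised as ℚᵘ
import Data.Rational.Unnormalised.Properties as ℚᵘ

n/1 : ℕ → ℚ
n/1 n = mkℚ (ℤ.+ n) 0 (coprime-sym (1-coprimeTo n))

ℕtoℚ≡n/1 : ∀ n → ℕtoℚ n ≡ n/1 n
ℕtoℚ≡n/1 n = ℚ.normalize-coprime (coprime-sym (1-coprimeTo n))

ℕtoℚ-+ : ∀ a b → ℕtoℚ (a ℕ.+ b) ≡ ℕtoℚ a + ℕtoℚ b
ℕtoℚ-+ a b rewrite ℕtoℚ≡n/1 a | ℕtoℚ≡n/1 b | ℕtoℚ≡n/1 (a ℕ.+ b) =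
  ℚ.toℚᵘ-injective (ℚᵘ.≃-trans (ℚᵘ.*≡* numerators) (ℚᵘ.≃-sym (ℚ.toℚᵘ-homo-+ (n/1 a) (n/1 b))))
  where
  numerators : ℤ.+ (a ℕ.+ b) ℤ.* ℤ.1ℤ ≡ (ℤ.+ a ℤ.* ℤ.1ℤ ℤ.+ ℤ.+ b ℤ.* ℤ.1ℤ) ℤ.* ℤ.1ℤ
  numerators = trans (ℤ.*-identityʳ (ℤ.+ (a ℕ.+ b)))
                     (sym (trans (ℤ.*-identityʳ (ℤ.+ a ℤ.* ℤ.1ℤ ℤ.+ ℤ.+ b ℤ.* ℤ.1ℤ))
                                 (cong₂ ℤ._+_ (ℤ.*-identityʳ (ℤ.+ a)) (ℤ.*-identityʳ (ℤ.+ b)))))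

ℕtoℚ-* : ∀ a b → ℕtoℚ (a ℕ.* b) ≡ ℕtoℚ a * ℕtoℚ b
ℕtoℚ-* a b rewrite ℕtoℚ≡n/1 a | ℕtoℚ≡n/1 b | ℕtoℚ≡n/1 (a ℕ.* b) =
  ℚ.toℚᵘ-injective (ℚᵘ.≃-trans (ℚᵘ.*≡* (cong (ℤ._* ℤ.1ℤ) (ℤ.pos-* a b)))
                               (ℚᵘ.≃-sym (ℚ.toℚᵘ-homo-* (n/1 a) (n/1 b))))

ℕtoℚ-suc : ∀ n → ℕtoℚ (suc n) ≡ ℕtoℚ n + 1ℚ
ℕtoℚ-suc n = trans (ℕtoℚ-+ 1 n) (ℚ.+-comm 1ℚ (ℕtoℚ n))

ℕtoℚ-mono-≤ : ∀ {a b} → a ≤ b → ℕtoℚ a ≤ℚ ℕtoℚ b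
ℕtoℚ-mono-≤ {a} {b} a≤b rewrite ℕtoℚ≡n/1 a | ℕtoℚ≡n/1 b =
  *≤* (subst₂ ℤ._≤_ (sym (ℤ.*-identityʳ _)) (sym (ℤ.*-identityʳ _)) (ℤ.+≤+ a≤b))

ℕtoℚ-cancel-≤ : ∀ {a b} → ℕtoℚ a ≤ℚ ℕtoℚ b → a ≤ b
ℕtoℚ-cancel-≤ {a} {b} a≤b rewrite ℕtoℚ≡n/1 a | ℕtoℚ≡n/1 b with a≤b
... | *≤* a≤b′ = ℤ.drop‿+≤+ (subst₂ ℤ._≤_ (ℤ.*-identityʳ _) (ℤ.*-identityʳ _) a≤b′)

0≤ℕtoℚ : ∀ n → 0ℚ ≤ℚ ℕtoℚ n
0≤ℕtoℚ n = ℕtoℚ-mono-≤ {0} {n} z≤n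

ℕtoℚ-positive : ∀ {n} → 1 ≤ n → Positive (ℕtoℚ n)
ℕtoℚ-positive {suc n} _ rewrite ℕtoℚ≡n/1 (suc n) = _

*-nonNeg : ∀ {p q} → 0ℚ ≤ℚ p → 0ℚ ≤ℚ q → 0ℚ ≤ℚ p * q
*-nonNeg {p} {q} 0≤p 0≤q = ℚ.nonNegative⁻¹ (p * q) {{ℚ.nonNeg*nonNeg⇒nonNeg p {{nonNegative 0≤p}} q {{nonNegative 0≤q}}}}

*-monoˡ-≤-nonNeg′ : ∀ {r p q} → 0ℚ ≤ℚ r → p ≤ℚ q → r * p ≤ℚ r * q
*-monoˡ-≤-nonNeg′ {r} 0≤r = ℚ.*-monoˡ-≤-nonNeg r {{nonNegative 0≤r}}

*-monoʳ-≤-nonNeg′ : ∀ {r p q} → 0ℚ ≤ℚ r → p ≤ℚ q → p * r ≤ℚ q * r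
*-monoʳ-≤-nonNeg′ {r} 0≤r = ℚ.*-monoʳ-≤-nonNeg r {{nonNegative 0≤r}}

module _ {A : Set} where

  sumℚ-nonNeg : {g : A → ℚ} (xs : List A) → All (λ v → 0ℚ ≤ℚ g v) xs → 0ℚ ≤ℚ sumℚ (map g xs)
  sumℚ-nonNeg []       []           = ℚ.≤-refl
  sumℚ-nonNeg (_ ∷ xs) (0≤gx ∷ 0≤g) = ℚ.+-mono-≤ 0≤gx (sumℚ-nonNeg xs 0≤g)

  prodℚ-nonNeg : {g : A → ℚ} (xs : List A) → All (λ v → 0ℚ ≤ℚ g v) xs → 0ℚ ≤ℚ prodℚ (map g xs)
  prodℚ-nonNeg []       []           = 0≤ℕtoℚ 1
  prodℚ-nonNeg (_ ∷ xs) (0≤gx ∷ 0≤g) = *-nonNeg 0≤gx (prodℚ-nonNeg xs 0≤g)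

  sumℚ-mono : {g h : A → ℚ} (xs : List A) → All (λ v → g v ≤ℚ h v) xs → sumℚ (map g xs) ≤ℚ sumℚ (map h xs)
  sumℚ-mono []       []            = ℚ.≤-refl
  sumℚ-mono (_ ∷ xs) (gx≤hx ∷ g≤h) = ℚ.+-mono-≤ gx≤hx (sumℚ-mono xs g≤h)

  sumℚ-*ʳ : (g : A → ℚ) (r : ℚ) (xs : List A) → sumℚ (map (λ v → g v * r) xs) ≡ sumℚ (map g xs) * r
  sumℚ-*ʳ g r []       = sym (ℚ.*-zeroˡ r)
  sumℚ-*ʳ g r (x ∷ xs) = trans (cong (λ s → g x * r + s) (sumℚ-*ʳ g r xs)) (sym (ℚ.*-distribʳ-+ r (g x) _))

  ≤-sumℚ : {g : A → ℚ} (xs : List A) → All (λ v → 0ℚ ≤ℚ g v) xs → ∀ {v} → v ∈ xs → g v ≤ℚ sumℚ (map g xs)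
  ≤-sumℚ {g} (v ∷ xs) (_ ∷ 0≤g) (here refl) =
    ℚ.≤-trans (ℚ.≤-reflexive (sym (ℚ.+-identityʳ (g v)))) (ℚ.+-monoʳ-≤ (g v) (sumℚ-nonNeg xs 0≤g))
  ≤-sumℚ {g} (_ ∷ xs) (0≤gx ∷ 0≤g) (there v∈) =
    ℚ.≤-trans (ℚ.≤-reflexive (sym (ℚ.+-identityˡ _))) (ℚ.+-mono-≤ 0≤gx (≤-sumℚ xs 0≤g v∈))

  ℕtoℚ-sum : (c : A → ℕ) (xs : List A) → ℕtoℚ (sum (map c xs)) ≡ sumℚ (map (λ v → ℕtoℚ (c v)) xs)
  ℕtoℚ-sum c []       = refl
  ℕtoℚ-sum c (x ∷ xs) = trans (ℕtoℚ-+ (c x) _) (cong (ℕtoℚ (c x) +_) (ℕtoℚ-sum c xs))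

  ℕtoℚ-product : (c : A → ℕ) (xs : List A) → ℕtoℚ (product (map c xs)) ≡ prodℚ (map (λ v → ℕtoℚ (c v)) xs)
  ℕtoℚ-product c []       = refl
  ℕtoℚ-product c (x ∷ xs) = trans (ℕtoℚ-* (c x) _) (cong (ℕtoℚ (c x) *_) (ℕtoℚ-product c xs))

module _ {A : Set} where

  edgePolyℚ : List (List A) → (A → ℚ) → ℚ
  edgePolyℚ E x = sumℚ (map (λ e → prodℚ (map x e)) E)

  ℕtoℚ-edgePoly : (c : A → ℕ) (E : List (List A)) → ℕtoℚ (edgePoly E c) ≡ edgePolyℚ E (λ v → ℕtoℚ (c v))
  ℕtoℚ-edgePoly c []      = refl
  ℕtoℚ-edgePoly c (e ∷ E) = trans (ℕtoℚ-+ (product (map c e)) _) (cong₂ _+_ (ℕtoℚ-product c e) (ℕtoℚ-edgePoly c E))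

  edgePolyℚ-cong : (E : List (List A)) {x y : A → ℚ} → (∀ v → x v ≡ y v) → edgePolyℚ E x ≡ edgePolyℚ E y
  edgePolyℚ-cong E x≡y = cong sumℚ (map-cong (λ e → cong prodℚ (map-cong x≡y e)) E)

  edgePolyℚ-nonNeg : (E : List (List A)) {x : A → ℚ} → (∀ v → 0ℚ ≤ℚ x v) → 0ℚ ≤ℚ edgePolyℚ E x
  edgePolyℚ-nonNeg E 0≤x = sumℚ-nonNeg E (All.universal (λ e → prodℚ-nonNeg e (All.universal 0≤x e)) E)

  edgePolyℚ-homogeneous : ∀ (x : A → ℚ) n d (E : List (List A)) → All (λ e → length e ≡ d) E →
                          edgePolyℚ E x * ℕtoℚ (n ^ d) ≡ edgePolyℚ E (λ v → ℕtoℚ n * x v)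
  edgePolyℚ-homogeneous x n d []      []               = ℚ.*-zeroˡ (ℕtoℚ (n ^ d))
  edgePolyℚ-homogeneous x n d (e ∷ E) (refl ∷ uniform) =
    trans (ℚ.*-distribʳ-+ (ℕtoℚ (n ^ length e)) (prodℚ (map x e)) _)
          (cong₂ _+_ (prodℚ-homogeneous e) (edgePolyℚ-homogeneous x n (length e) E uniform))
    where
    open +-*-Solver
    prodℚ-homogeneous : ∀ e → prodℚ (map x e) * ℕtoℚ (n ^ length e) ≡ prodℚ (map (λ v → ℕtoℚ n * x v) e)
    prodℚ-homogeneous []      = ℚ.*-identityˡ 1ℚ
    prodℚ-homogeneous (v ∷ e) = begin
      (x v * prodℚ (map x e)) * ℕtoℚ (n ℕ.* n ^ length e)
        ≡⟨ cong ((x v * prodℚ (map x e)) *_) (ℕtoℚ-* n (n ^ length e)) ⟩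
      (x v * prodℚ (map x e)) * (ℕtoℚ n * ℕtoℚ (n ^ length e))
        ≡⟨ solve 4 (λ a b c d → (a :* b) :* (c :* d) := (c :* a) :* (b :* d)) refl
                   (x v) (prodℚ (map x e)) (ℕtoℚ n) (ℕtoℚ (n ^ length e)) ⟩
      (ℕtoℚ n * x v) * (prodℚ (map x e) * ℕtoℚ (n ^ length e))
        ≡⟨ cong ((ℕtoℚ n * x v) *_) (prodℚ-homogeneous e) ⟩
      (ℕtoℚ n * x v) * prodℚ (map (λ v → ℕtoℚ n * x v) e) ∎
      where open ≡-Reasoning

∃-floor : (y : ℚ) → 0ℚ ≤ℚ y → (t : ℕ) → y <ℚ ℕtoℚ t + 1ℚ → ∃ λ m → ℕtoℚ m ≤ℚ y × y <ℚ ℕtoℚ m + 1ℚ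
∃-floor y 0≤y zero    y<1   = 0 , 0≤y , y<1
∃-floor y 0≤y (suc t) y<t+2 with ℕtoℚ (suc t) ℚ.≤? y
... | yes t+1≤y = suc t , t+1≤y , y<t+2
... | no  t+1≰y = ∃-floor y 0≤y t (subst (y <ℚ_) (ℕtoℚ-suc t) (ℚ.≰⇒> t+1≰y))

module Rounding {A : Set} (n : ℕ) (y : A → ℚ) (m : A → ℕ)
                (0≤y : ∀ v → 0ℚ ≤ℚ y v) (m≤y : ∀ v → ℕtoℚ (m v) ≤ℚ y v)
                (y≤m+1 : ∀ v → y v ≤ℚ ℕtoℚ (m v) + 1ℚ) (y≤n : ∀ v → y v ≤ℚ ℕtoℚ n) where

  private
    N : ℚ
    N = ℕtoℚ n
    0≤N : 0ℚ ≤ℚ N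
    0≤N = 0≤ℕtoℚ n

  prodℚ≤pow : ∀ e → prodℚ (map y e) ≤ℚ ℕtoℚ (n ^ length e)
  prodℚ≤pow []      = ℚ.≤-refl
  prodℚ≤pow (v ∷ e) = begin
    y v * prodℚ (map y e)       ≤⟨ *-monoʳ-≤-nonNeg′ (prodℚ-nonNeg e (All.universal 0≤y e)) (y≤n v) ⟩
    N * prodℚ (map y e)         ≤⟨ *-monoˡ-≤-nonNeg′ 0≤N (prodℚ≤pow e) ⟩
    N * ℕtoℚ (n ^ length e)     ≡⟨ sym (ℕtoℚ-* n (n ^ length e)) ⟩
    ℕtoℚ (n ^ length (v ∷ e))   ∎
    where open ℚ.≤-Reasoning

  -- Multiplied by n to avoid the exponent |e| - 1: raising one factor from m v to y v ≤ m v + 1 adds at most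
  -- the product of the other factors, which is ≤ n^(|e| - 1).
  prodℚ-rounding : ∀ e → N * prodℚ (map y e) ≤ℚ N * ℕtoℚ (product (map m e)) + ℕtoℚ (length e) * ℕtoℚ (n ^ length e)
  prodℚ-rounding []      = ℚ.≤-reflexive (sym (ℚ.+-identityʳ (N * 1ℚ)))
  prodℚ-rounding (v ∷ e) = begin
    N * (y v * Y)
      ≤⟨ *-monoˡ-≤-nonNeg′ 0≤N (*-monoʳ-≤-nonNeg′ 0≤Y (y≤m+1 v)) ⟩
    N * ((Mv + 1ℚ) * Y)
      ≡⟨ solve 3 (λ N Mv Y → N :* ((Mv :+ con 1ℚ) :* Y) := Mv :* (N :* Y) :+ N :* Y) refl N Mv Y ⟩
    Mv * (N * Y) + N * Y
      ≤⟨ ℚ.+-mono-≤ (*-monoˡ-≤-nonNeg′ 0≤Mv (prodℚ-rounding e)) (*-monoˡ-≤-nonNeg′ 0≤N (prodℚ≤pow e)) ⟩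
    Mv * (N * M + L * P) + N * P
      ≡⟨ solve 5 (λ N Mv M L P → Mv :* (N :* M :+ L :* P) :+ N :* P := N :* (Mv :* M) :+ Mv :* (L :* P) :+ N :* P)
                 refl N Mv M L P ⟩
    N * (Mv * M) + Mv * (L * P) + N * P
      ≤⟨ ℚ.+-monoˡ-≤ (N * P) (ℚ.+-monoʳ-≤ (N * (Mv * M)) (*-monoʳ-≤-nonNeg′ (*-nonNeg 0≤L 0≤P) Mv≤N)) ⟩
    N * (Mv * M) + N * (L * P) + N * P
      ≡⟨ solve 5 (λ N Mv M L P → N :* (Mv :* M) :+ N :* (L :* P) :+ N :* P := N :* (Mv :* M) :+ (L :+ con 1ℚ) :* (N :* P))
                 refl N Mv M L P ⟩
    N * (Mv * M) + (L + 1ℚ) * (N * P)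
      ≡⟨ sym (cong₂ (λ a b → N * a + b) (ℕtoℚ-* (m v) _) (cong₂ _*_ (ℕtoℚ-suc (length e)) (ℕtoℚ-* n _))) ⟩
    N * ℕtoℚ (m v ℕ.* product (map m e)) + ℕtoℚ (suc (length e)) * ℕtoℚ (n ^ suc (length e)) ∎
    where
    open ℚ.≤-Reasoning
    open +-*-Solver
    Y : ℚ
    Y = prodℚ (map y e)
    M : ℚ
    M = ℕtoℚ (product (map m e))
    L : ℚ
    L = ℕtoℚ (length e)
    P : ℚ
    P = ℕtoℚ (n ^ length e)
    Mv : ℚ
    Mv = ℕtoℚ (m v)
    0≤Y : 0ℚ ≤ℚ Y
    0≤Y = prodℚ-nonNeg e (All.universal 0≤y e)
    0≤Mv : 0ℚ ≤ℚ Mv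
    0≤Mv = 0≤ℕtoℚ (m v)
    0≤L : 0ℚ ≤ℚ L
    0≤L = 0≤ℕtoℚ (length e)
    0≤P : 0ℚ ≤ℚ P
    0≤P = 0≤ℕtoℚ (n ^ length e)
    Mv≤N : Mv ≤ℚ N
    Mv≤N = ℚ.≤-trans (m≤y v) (y≤n v)

  edgePolyℚ-rounding : ∀ d (E : List (List A)) → All (λ e → length e ≡ d) E →
                       N * edgePolyℚ E y ≤ℚ N * ℕtoℚ (edgePoly E m) + ℕtoℚ (length E) * (ℕtoℚ d * ℕtoℚ (n ^ d))
  edgePolyℚ-rounding d []      []               =
    ℚ.≤-reflexive (trans (ℚ.*-zeroʳ N) (sym (trans (cong₂ _+_ (ℚ.*-zeroʳ N) (ℚ.*-zeroˡ D)) (ℚ.+-identityʳ 0ℚ))))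
    where
    D : ℚ
    D = ℕtoℚ d * ℕtoℚ (n ^ d)
  edgePolyℚ-rounding d (e ∷ E) (refl ∷ uniform) = begin
    N * (Y + Z)
      ≡⟨ ℚ.*-distribˡ-+ N Y Z ⟩
    N * Y + N * Z
      ≤⟨ ℚ.+-mono-≤ (prodℚ-rounding e) (edgePolyℚ-rounding d E uniform) ⟩
    (N * M + D) + (N * S + K * D)
      ≡⟨ solve 5 (λ N M S K D → (N :* M :+ D) :+ (N :* S :+ K :* D) := N :* (M :+ S) :+ (K :+ con 1ℚ) :* D) refl N M S K D ⟩
    N * (M + S) + (K + 1ℚ) * D
      ≡⟨ sym (cong₂ (λ a b → N * a + b * D) (ℕtoℚ-+ (product (map m e)) _) (ℕtoℚ-suc (length E))) ⟩
    N * ℕtoℚ (edgePoly (e ∷ E) m) + ℕtoℚ (length (e ∷ E)) * D ∎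
    where
    open ℚ.≤-Reasoning
    open +-*-Solver
    Y : ℚ
    Y = prodℚ (map y e)
    Z : ℚ
    Z = edgePolyℚ E y
    M : ℚ
    M = ℕtoℚ (product (map m e))
    S : ℚ
    S = ℕtoℚ (edgePoly E m)
    K : ℚ
    K = ℕtoℚ (length E)
    D : ℚ
    D = ℕtoℚ d * ℕtoℚ (n ^ d)

module _ {k : ℕ} where

  edges-uniform : ∀ d → All (λ e → length e ≡ d) (edges k d)
  edges-uniform d = All.tabulate (λ e∈ → proj₂ (proj₂ (∈-edges⁻ e∈)))

  -- Round each n x_v down to an integer m_v; the m_v copies of each v fit into n columns.
  lagPoly≤f+error : ∀ d n (x : Vertex k → ℚ) → InSimplex k x →
                    ℕtoℚ n * (lagPoly k d x * ℕtoℚ (n ^ d)) ≤ℚ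
                    ℕtoℚ n * ℕtoℚ (f n k d) + ℕtoℚ (length (edges k d)) * (ℕtoℚ d * ℕtoℚ (n ^ d))
  lagPoly≤f+error d n x (0≤x , Σx≡1) = begin
    N * (lagPoly k d x * ℕtoℚ (n ^ d))
      ≡⟨ cong (N *_) (edgePolyℚ-homogeneous x n d (edges k d) (edges-uniform d)) ⟩
    N * edgePolyℚ (edges k d) y
      ≤⟨ Rounding.edgePolyℚ-rounding n y m 0≤y m≤y y≤m+1 y≤N d (edges k d) (edges-uniform d) ⟩
    N * ℕtoℚ (edgePoly (edges k d) m) + error
      ≤⟨ ℚ.+-monoˡ-≤ error (*-monoˡ-≤-nonNeg′ (0≤ℕtoℚ n) (ℕtoℚ-mono-≤ (edgePoly≤f d m Σm≤n))) ⟩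
    N * ℕtoℚ (f n k d) + error ∎
    where
    open ℚ.≤-Reasoning
    N : ℚ
    N = ℕtoℚ n
    error : ℚ
    error = ℕtoℚ (length (edges k d)) * (ℕtoℚ d * ℕtoℚ (n ^ d))
    y : Vertex k → ℚ
    y v = N * x v
    0≤y : ∀ v → 0ℚ ≤ℚ y v
    0≤y v = *-nonNeg (0≤ℕtoℚ n) (All.lookup 0≤x (∈-allSubsets v))
    y≤N : ∀ v → y v ≤ℚ N
    y≤N v = ℚ.≤-trans (*-monoˡ-≤-nonNeg′ (0≤ℕtoℚ n) (subst (x v ≤ℚ_) Σx≡1 (≤-sumℚ (allSubsets k) 0≤x (∈-allSubsets v))))
                      (ℚ.≤-reflexive (ℚ.*-identityʳ N))
    floor : ∀ v → ∃ λ m → ℕtoℚ m ≤ℚ y v × y v <ℚ ℕtoℚ m + 1ℚ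
    floor v = ∃-floor (y v) (0≤y v) n (ℚ.≤-<-trans (y≤N v) (subst (_<ℚ N + 1ℚ) (ℚ.+-identityʳ N) (ℚ.+-monoʳ-< N (ℚ.positive⁻¹ 1ℚ))))
    m : Vertex k → ℕ
    m v = proj₁ (floor v)
    m≤y : ∀ v → ℕtoℚ (m v) ≤ℚ y v
    m≤y v = proj₁ (proj₂ (floor v))
    y≤m+1 : ∀ v → y v ≤ℚ ℕtoℚ (m v) + 1ℚ
    y≤m+1 v = ℚ.<⇒≤ (proj₂ (proj₂ (floor v)))
    Σm≤n : sum (map m (allSubsets k)) ≤ n
    Σm≤n = ℕtoℚ-cancel-≤ (begin
      ℕtoℚ (sum (map m (allSubsets k)))              ≡⟨ ℕtoℚ-sum m (allSubsets k) ⟩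
      sumℚ (map (λ v → ℕtoℚ (m v)) (allSubsets k))  ≤⟨ sumℚ-mono (allSubsets k) (All.universal m≤y _) ⟩
      sumℚ (map y (allSubsets k))                   ≡⟨ cong sumℚ (map-cong (λ v → ℚ.*-comm N (x v)) (allSubsets k)) ⟩
      sumℚ (map (λ v → x v * N) (allSubsets k))     ≡⟨ sumℚ-*ʳ x N (allSubsets k) ⟩
      sumℚ (map x (allSubsets k)) * N               ≡⟨ cong (_* N) Σx≡1 ⟩
      1ℚ * N                                        ≡⟨ ℚ.*-identityˡ N ⟩
      N                                             ∎)

lagPoly-nonNeg : ∀ {k} d {x : Vertex k → ℚ} → InSimplex k x → 0ℚ ≤ℚ lagPoly k d x
lagPoly-nonNeg {k} d (0≤x , _) = edgePolyℚ-nonNeg (edges k d) (λ v → All.lookup 0≤x (∈-allSubsets v))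

archimedean : (ε : ℚ) → Positive ε → (M : ℕ) → ∃ λ N → ∀ n → N ≤ n → ℕtoℚ M ≤ℚ ε * ℕtoℚ n
archimedean ε@(mkℚ (ℤ.+[1+ a ]) b _) _ M = M ℕ.* suc b , λ n M[1+b]≤n → begin
  ℕtoℚ M                          ≤⟨ ℕtoℚ-mono-≤ (ℕ.m≤n*m M (suc a)) ⟩
  ℕtoℚ (suc a ℕ.* M)              ≡⟨ ℕtoℚ-* (suc a) M ⟩
  ℕtoℚ (suc a) * ℕtoℚ M           ≡⟨ cong (_* ℕtoℚ M) (sym ε*[1+b]≡1+a) ⟩
  ε * ℕtoℚ (suc b) * ℕtoℚ M       ≡⟨ ℚ.*-assoc ε (ℕtoℚ (suc b)) (ℕtoℚ M) ⟩
  ε * (ℕtoℚ (suc b) * ℕtoℚ M)     ≡⟨ cong (ε *_) (trans (sym (ℕtoℚ-* (suc b) M)) (cong ℕtoℚ (ℕ.*-comm (suc b) M))) ⟩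
  ε * ℕtoℚ (M ℕ.* suc b)          ≤⟨ ℚ.*-monoˡ-≤-nonNeg ε (ℕtoℚ-mono-≤ M[1+b]≤n) ⟩
  ε * ℕtoℚ n                      ∎
  where
  open ℚ.≤-Reasoning
  ε*[1+b]≡1+a : ε * ℕtoℚ (suc b) ≡ ℕtoℚ (suc a)
  ε*[1+b]≡1+a rewrite ℕtoℚ≡n/1 (suc b) | ℕtoℚ≡n/1 (suc a) =
    ℚ.toℚᵘ-injective (ℚᵘ.≃-trans (ℚ.toℚᵘ-homo-* ε (n/1 (suc b)))
                                (ℚᵘ.*≡* (trans (ℤ.*-identityʳ _) (cong (λ z → ℤ.+ suc a ℤ.* ℤ.+ suc z) (sym (ℕ.*-identityʳ b))))))

≤-[1+ε]*⇒[1-ε]*≤ : ∀ {ε W F} → 0ℚ ≤ℚ ε → 0ℚ ≤ℚ W → 0ℚ ≤ℚ F → W ≤ℚ (1ℚ + ε) * F → (1ℚ - ε) * W ≤ℚ F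
≤-[1+ε]*⇒[1-ε]*≤ {ε} {W} {F} 0≤ε 0≤W 0≤F W≤[1+ε]F with ε ℚ.≤? 1ℚ
... | yes ε≤1 = begin
  (1ℚ - ε) * W                ≤⟨ *-monoˡ-≤-nonNeg′ 0≤1-ε W≤[1+ε]F ⟩
  (1ℚ - ε) * ((1ℚ + ε) * F)   ≡⟨ solve 2 (λ ε F → (con 1ℚ :- ε) :* ((con 1ℚ :+ ε) :* F) := F :- ε :* ε :* F) refl ε F ⟩
  F - ε * ε * F               ≤⟨ ℚ.+-monoʳ-≤ F (ℚ.neg-antimono-≤ (*-nonNeg (*-nonNeg 0≤ε 0≤ε) 0≤F)) ⟩
  F - 0ℚ                      ≡⟨ ℚ.+-identityʳ F ⟩
  F                           ∎
  where
  open ℚ.≤-Reasoning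
  open +-*-Solver
  0≤1-ε : 0ℚ ≤ℚ 1ℚ - ε
  0≤1-ε = subst (_≤ℚ 1ℚ - ε) (ℚ.+-inverseʳ ε) (ℚ.+-monoˡ-≤ (- ε) ε≤1)
... | no ε≰1 = begin
  (1ℚ - ε) * W    ≤⟨ *-monoʳ-≤-nonNeg′ 0≤W 1-ε≤0 ⟩
  0ℚ * W          ≡⟨ ℚ.*-zeroˡ W ⟩
  0ℚ              ≤⟨ 0≤F ⟩
  F               ∎
  where
  open ℚ.≤-Reasoning
  1-ε≤0 : 1ℚ - ε ≤ℚ 0ℚ
  1-ε≤0 = subst (1ℚ - ε ≤ℚ_) (ℚ.+-inverseʳ ε) (ℚ.+-monoˡ-≤ (- ε) (ℚ.<⇒≤ (ℚ.≰⇒> ε≰1)))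

≤-weaken-[1+ε] : ∀ {ε a b F} → 0ℚ ≤ℚ ε → 0ℚ ≤ℚ a → 0ℚ ≤ℚ b → F ≤ℚ a * b → F ≤ℚ ((1ℚ + ε) * a) * b
≤-weaken-[1+ε] {ε} {a} {b} {F} 0≤ε 0≤a 0≤b F≤ab = begin
  F                    ≤⟨ F≤ab ⟩
  a * b                ≡⟨ sym (ℚ.+-identityʳ (a * b)) ⟩
  a * b + 0ℚ           ≤⟨ ℚ.+-monoʳ-≤ (a * b) (*-nonNeg (*-nonNeg 0≤ε 0≤a) 0≤b) ⟩
  a * b + ε * a * b    ≡⟨ solve 3 (λ ε a b → a :* b :+ ε :* a :* b := (con 1ℚ :+ ε) :* a :* b) refl ε a b ⟩
  (1ℚ + ε) * a * b     ∎
  where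
  open ℚ.≤-Reasoning
  open +-*-Solver

-- Rounding loses at most |H(k,d)| d n^(d-1), while f n k d ≥ (n / 2^(k+1))^d; for large n the loss is below ε f n k d.
lower-bound : ∀ k d (ε : ℚ) → Positive ε → ∃ λ N → ∀ n → N ≤ n → (x : Vertex k → ℚ) → InSimplex k x →
              ((1ℚ - ε) * lagPoly k d x) * ℕtoℚ (n ^ d) ≤ℚ ℕtoℚ (f n k d)
lower-bound k d ε ε>0 = suc (N₁ ℕ.+ 2 ^ k) , bound
  where
  K : ℕ
  K = length (edges k d)
  M : ℕ
  M = K ℕ.* (d ℕ.* (2 ^ suc k) ^ d)
  N₁ : ℕ
  N₁ = proj₁ (archimedean ε ε>0 M)
  bound : ∀ n → suc (N₁ ℕ.+ 2 ^ k) ≤ n → (x : Vertex k → ℚ) → InSimplex k x →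
          ((1ℚ - ε) * lagPoly k d x) * ℕtoℚ (n ^ d) ≤ℚ ℕtoℚ (f n k d)
  bound n N<n x x∈Δ =
    subst (_≤ℚ F) (sym (ℚ.*-assoc (1ℚ - ε) (lagPoly k d x) (ℕtoℚ (n ^ d))))
          (≤-[1+ε]*⇒[1-ε]*≤ (ℚ.<⇒≤ (ℚ.positive⁻¹ ε {{ε>0}})) 0≤W (0≤ℕtoℚ (f n k d))
                            (ℚ.*-cancelˡ-≤-pos N {{ℕtoℚ-positive 1≤n}} N*W≤N*[1+ε]F))
    where
    open ℚ.≤-Reasoning
    1≤n : 1 ≤ n
    1≤n = ℕ.≤-trans (s≤s z≤n) N<n
    2^k≤n : 2 ^ k ≤ n
    2^k≤n = ℕ.≤-trans (ℕ.m≤n+m (2 ^ k) (suc N₁)) N<n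
    N₁≤n : N₁ ≤ n
    N₁≤n = ℕ.≤-trans (ℕ.m≤n⇒m≤1+n (ℕ.m≤m+n N₁ (2 ^ k))) N<n
    N : ℚ
    N = ℕtoℚ n
    F : ℚ
    F = ℕtoℚ (f n k d)
    W : ℚ
    W = lagPoly k d x * ℕtoℚ (n ^ d)
    0≤W : 0ℚ ≤ℚ W
    0≤W = *-nonNeg (lagPoly-nonNeg {k} d {x} x∈Δ) (0≤ℕtoℚ (n ^ d))
    error≤εNF : ℕtoℚ K * (ℕtoℚ d * ℕtoℚ (n ^ d)) ≤ℚ ε * N * F
    error≤εNF = begin
      ℕtoℚ K * (ℕtoℚ d * ℕtoℚ (n ^ d))  ≡⟨ sym (trans (ℕtoℚ-* K _) (cong (ℕtoℚ K *_) (ℕtoℚ-* d _))) ⟩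
      ℕtoℚ (K ℕ.* (d ℕ.* n ^ d))        ≤⟨ ℕtoℚ-mono-≤ (rounding-error≤f {k = k} d 2^k≤n) ⟩
      ℕtoℚ (M ℕ.* f n k d)              ≡⟨ ℕtoℚ-* M (f n k d) ⟩
      ℕtoℚ M * F                         ≤⟨ *-monoʳ-≤-nonNeg′ (0≤ℕtoℚ (f n k d)) (proj₂ (archimedean ε ε>0 M) n N₁≤n) ⟩
      ε * N * F                          ∎
    N*W≤N*[1+ε]F : N * W ≤ℚ N * ((1ℚ + ε) * F)
    N*W≤N*[1+ε]F = begin
      N * W                                       ≤⟨ lagPoly≤f+error d n x x∈Δ ⟩
      N * F + ℕtoℚ K * (ℕtoℚ d * ℕtoℚ (n ^ d))   ≤⟨ ℚ.+-monoʳ-≤ (N * F) error≤εNF ⟩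
      N * F + ε * N * F                           ≡⟨ solve 3 (λ N F ε → N :* F :+ ε :* N :* F := N :* ((con 1ℚ :+ ε) :* F)) refl N F ε ⟩
      N * ((1ℚ + ε) * F)                          ∎
      where open +-*-Solver

-- x is the distribution of the columns of an extremal matrix.
upper-bound : ∀ k d {n} → 1 ≤ n → ∃ λ (x : Vertex k → ℚ) → InSimplex k x × ℕtoℚ (f n k d) ≤ℚ lagPoly k d x * ℕtoℚ (n ^ d)
upper-bound k d {n} 1≤n = x , (All.universal 0≤x (allSubsets k) , Σx≡1) , bound
  where
  open Enumeration {Vertex k} (≡-dec _≟ᴮ_) using (multiplicity; sum-multiplicity)
  cols : Vec (Vertex k) n
  cols = proj₁ (f≤edgePoly-multiplicity n d)
  c : Vertex k → ℕ
  c = multiplicity (toList cols)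
  N : ℚ
  N = ℕtoℚ n
  instance
    N≢0 : NonZero N
    N≢0 = ℚ.pos⇒nonZero N {{ℕtoℚ-positive 1≤n}}
  x : Vertex k → ℚ
  x v = ℕtoℚ (c v) * 1/ N
  0≤x : ∀ v → 0ℚ ≤ℚ x v
  0≤x v = *-nonNeg (0≤ℕtoℚ (c v)) (ℚ.nonNegative⁻¹ (1/ N) {{ℚ.pos⇒nonNeg (1/ N) {{ℚ.1/pos⇒pos N {{ℕtoℚ-positive 1≤n}}}}}})
  Σc≡n : sum (map c (allSubsets k)) ≡ n
  Σc≡n = trans (sum-multiplicity (Unique-allSubsets k) (toList cols) (λ {v} _ → ∈-allSubsets v)) (length-toList cols)
  Σx≡1 : sumℚ (map x (allSubsets k)) ≡ 1ℚ
  Σx≡1 = begin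
    sumℚ (map x (allSubsets k))                           ≡⟨ sumℚ-*ʳ (λ v → ℕtoℚ (c v)) (1/ N) (allSubsets k) ⟩
    sumℚ (map (λ v → ℕtoℚ (c v)) (allSubsets k)) * 1/ N  ≡⟨ cong (_* 1/ N) (sym (ℕtoℚ-sum c (allSubsets k))) ⟩
    ℕtoℚ (sum (map c (allSubsets k))) * 1/ N              ≡⟨ cong (λ s → ℕtoℚ s * 1/ N) Σc≡n ⟩
    N * 1/ N                                              ≡⟨ ℚ.*-inverseʳ N ⟩
    1ℚ                                                    ∎
    where open ≡-Reasoning
  c≡N*x : ∀ v → ℕtoℚ (c v) ≡ N * x v
  c≡N*x v = sym (begin
    N * (ℕtoℚ (c v) * 1/ N)   ≡⟨ solve 3 (λ N c i → N :* (c :* i) := c :* (N :* i)) refl N (ℕtoℚ (c v)) (1/ N) ⟩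
    ℕtoℚ (c v) * (N * 1/ N)   ≡⟨ cong (ℕtoℚ (c v) *_) (ℚ.*-inverseʳ N) ⟩
    ℕtoℚ (c v) * 1ℚ           ≡⟨ ℚ.*-identityʳ (ℕtoℚ (c v)) ⟩
    ℕtoℚ (c v)                ∎)
    where
    open ≡-Reasoning
    open +-*-Solver
  bound : ℕtoℚ (f n k d) ≤ℚ lagPoly k d x * ℕtoℚ (n ^ d)
  bound = begin
    ℕtoℚ (f n k d)                              ≤⟨ ℕtoℚ-mono-≤ (proj₂ (f≤edgePoly-multiplicity n d)) ⟩
    ℕtoℚ (edgePoly (edges k d) c)               ≡⟨ ℕtoℚ-edgePoly c (edges k d) ⟩
    edgePolyℚ (edges k d) (λ v → ℕtoℚ (c v))   ≡⟨ edgePolyℚ-cong (edges k d) c≡N*x ⟩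
    edgePolyℚ (edges k d) (λ v → N * x v)       ≡⟨ sym (edgePolyℚ-homogeneous x n d (edges k d) (edges-uniform d)) ⟩
    lagPoly k d x * ℕtoℚ (n ^ d)                ∎
    where open ℚ.≤-Reasoning

corollary2p4 : (d k : ℕ) → 1 ≤ d → 2 ^ d ≤ k →
    (ε : ℚ) → Positive ε →
    ∃ λ N → (n : ℕ) → N ≤ n →
      ((x : Vertex k → ℚ) → InSimplex k x →
         ((1ℚ - ε) * lagPoly k d x) * ℕtoℚ (n ^ d) ≤ℚ ℕtoℚ (f n k d))
      × ∃ λ (x : Vertex k → ℚ) → InSimplex k x ×
         ℕtoℚ (f n k d) ≤ℚ ((1ℚ + ε) * lagPoly k d x) * ℕtoℚ (n ^ d)
corollary2p4 d k _ _ ε ε>0 =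
  let (N , lower) = lower-bound k d ε ε>0 in
  suc N , λ n N<n →
    let (x , x∈Δ , f≤) = upper-bound k d (ℕ.≤-trans (s≤s z≤n) N<n) in
    lower n (ℕ.<⇒≤ N<n) ,
    x , x∈Δ , ≤-weaken-[1+ε] (ℚ.<⇒≤ (ℚ.positive⁻¹ ε {{ε>0}})) (lagPoly-nonNeg d x∈Δ) (0≤ℕtoℚ (n ^ d)) f≤
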